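{- For any $u,v\in\mathfrak{H}$, in the formal power series ring $\mathfrak{H}[[X,Y]]$, \[ ug_{1}\frac{1}{1-aX}\sqcup\!\sqcup_{\hbar}vg_{1}\frac{1}{1-aY}=\Big\{(1+\hbar X)\Big(ug_{1}\frac{1}{1-aX}\sqcup\!\sqcup_{\hbar}v\Big)+(1+\hbar Y)\Big(u\sqcup\!\sqcup_{\hbar}vg_{1}\frac{1}{1-aY}\Big)+(u\sqcup\!\sqcup_{\hbar}v)(e_{1}-g_{1})\Big\}\,g_{1}\frac{1}{1-a(X+Y+\hbar XY)}. \]
   Context: Let $\mathcal{C}=\mathbb{Q}[\hbar]$ ($\hbar$ a formal variable), $\mathfrak{H}=\mathcal{C}\langle a,b\rangle$ the non-commutative polynomial ring, $g_1=ba$, $e_1=b(a+\hbar)$. The shuffle product $\sqcup\!\sqcup_{\hbar}$ is the $\mathcal{C}$-bilinear product on $\mathfrak{H}$ with $w\sqcup\!\sqcup_{\hbar}1=1\sqcup\!\sqcup_{\hbar}w=w$, $wa\sqcup\!\sqcup_{\hbar}w'a=(wa\sqcup\!\sqcup_{\hbar}w'+w\sqcup\!\sqcup_{\hbar}w'a+\hbar\,w\sqcup\!\sqcup_{\hbar}w')a$, $wb\sqcup\!\sqcup_{\hbar}w'=w\sqcup\!\sqcup_{\hbar}w'b=(w\sqcup\!\sqcup_{\hbar}w')b$ for $w,w'\in\mathfrak{H}$. It is extended to formal power series with coefficients in $\mathfrak{H}$ coefficientwise: $\sum_{i}a_iX^i\sqcup\!\sqcup_\hbar\sum_j b_jY^j=\sum_{i,j}(a_i\sqcup\!\sqcup_\hbar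 b_j)X^iY^j$ (variables commute with everything), and $\frac{1}{1-aX}=\sum_{n\ge0}a^nX^n$. -}

module Defs where

open import Data.Bool using (Bool; true; false; _∧_; if_then_else_)
open import Data.Nat using (ℕ; zero; suc; _+_; _∸_; _≡ᵇ_)
open import Data.Rational using (ℚ; 0ℚ; 1ℚ; -_) renaming (_+_ to _+ℚ_; _*_ to _*ℚ_)
open import Data.List using (List; []; _∷_; _++_; map; concatMap)
open import Data.Product using (_×_; _,_)
open import Relation.Binary.PropositionalEquality using (_≡_)

-- Words in the letters a, b.  Words are "snoc" lists: (w ▸ x) is the
-- word w followed by the letter x (the recursion of the shuffle product
-- peels letters off the right end).

data Letter : Set where
  𝕒 𝕓 : Letter

data Word : Set where
  ε   : Word
  _▸_ : Word → Letter → Word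

infixl 6 _▸_

_==L_ : Letter → Letter → Bool
𝕒 ==L 𝕒 = true
𝕓 ==L 𝕓 = true
_ ==L _ = false

_==W_ : Word → Word → Bool
ε ==W ε = true
(w ▸ x) ==W (w' ▸ y) = (w ==W w') ∧ (x ==L y)
_ ==W _ = false

_·W_ : Word → Word → Word
w ·W ε = w
w ·W (w' ▸ x) = (w ·W w') ▸ x

-- 𝔥 = ℚ[ħ]⟨a,b⟩ as the free ℚ-module on the monomials ħ^k w
-- (k : ℕ, w a word).  An element is a finite formal sum of terms
-- (q , k , w) meaning q ħ^k w; two elements are equal (_≈_) iff all
-- their coefficients agree.

Term : Set
Term = ℚ × ℕ × Word

𝔥 : Set
𝔥 = List Term

coeff : ℕ → Word → 𝔥 → ℚ
coeff k w [] = 0ℚ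
coeff k w ((q , k' , w') ∷ t) =
  (if (k ≡ᵇ k') ∧ (w ==W w') then q else 0ℚ) +ℚ coeff k w t

infix 4 _≈_
_≈_ : 𝔥 → 𝔥 → Set
x ≈ y = ∀ k w → coeff k w x ≡ coeff k w y

𝟘 : 𝔥
𝟘 = []

word : Word → 𝔥
word w = (1ℚ , 0 , w) ∷ []

𝟙 : 𝔥
𝟙 = word ε

letter-a : 𝔥
letter-a = word (ε ▸ 𝕒)

letter-b : 𝔥
letter-b = word (ε ▸ 𝕓)

ħ : 𝔥
ħ = (1ℚ , 1 , ε) ∷ []

infixl 6 _⊕_ _⊖_
_⊕_ : 𝔥 → 𝔥 → 𝔥
_⊕_ = _++_

neg : 𝔥 → 𝔥
neg = map (λ { (q , k , w) → (- q , k , w) })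

_⊖_ : 𝔥 → 𝔥 → 𝔥
x ⊖ y = x ⊕ neg y

ħ· : 𝔥 → 𝔥
ħ· = map (λ { (q , k , w) → (q , suc k , w) })

infixl 7 _⊗_
_⊗_ : 𝔥 → 𝔥 → 𝔥
x ⊗ y = concatMap (λ { (q , k , w) →
          map (λ { (q' , k' , w') → (q *ℚ q' , k + k' , w ·W w') }) y }) x

_◂_ : 𝔥 → Letter → 𝔥
x ◂ l = map (λ { (q , k , w) → (q , k , w ▸ l) }) x

g₁ : 𝔥
g₁ = letter-b ⊗ letter-a

e₁ : 𝔥
e₁ = letter-b ⊗ (letter-a ⊕ ħ)

shW : Word → Word → 𝔥
shW ε w' = word w'
shW (w ▸ x) ε = word (w ▸ x)
shW (w ▸ 𝕓) w' = shW w w' ◂ 𝕓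
shW (w ▸ 𝕒) (w' ▸ 𝕓) = shW (w ▸ 𝕒) w' ◂ 𝕓
shW (w ▸ 𝕒) (w' ▸ 𝕒) =
  (shW (w ▸ 𝕒) w' ⊕ shW w (w' ▸ 𝕒) ⊕ ħ· (shW w w')) ◂ 𝕒

infixl 7 _ш_
_ш_ : 𝔥 → 𝔥 → 𝔥
x ш y = concatMap (λ { (q , k , w) →
          concatMap (λ { (q' , k' , w') →
            map (λ { (r , m , v) → (q *ℚ q' *ℚ r , k + k' + m , v) })
                (shW w w') }) y }) x

-- Formal power series 𝔥[[X,Y]]: a series is its coefficient function,
-- F i j = coefficient of X^i Y^j.  X, Y commute with everything.

Ser : Set
Ser = ℕ → ℕ → 𝔥

infix 4 _≈S_
_≈S_ : Ser → Ser → Set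
F ≈S G = ∀ i j → F i j ≈ G i j

sum𝔥 : ℕ → (ℕ → 𝔥) → 𝔥
sum𝔥 zero f = 𝟘
sum𝔥 (suc n) f = sum𝔥 n f ⊕ f n

cst : 𝔥 → Ser
cst h zero zero = h
cst h _ _ = 𝟘

Xs : Ser
Xs (suc zero) zero = 𝟙
Xs _ _ = 𝟘

Ys : Ser
Ys zero (suc zero) = 𝟙
Ys _ _ = 𝟘

infixl 6 _+S_
_+S_ : Ser → Ser → Ser
(F +S G) i j = F i j ⊕ G i j

infixl 7 _*S_
_*S_ : Ser → Ser → Ser
(F *S G) i j = sum𝔥 (suc i) λ i₁ → sum𝔥 (suc j) λ j₁ →
                 F i₁ j₁ ⊗ G (i ∸ i₁) (j ∸ j₁)

infixl 7 _шS_
_шS_ : Ser → Ser → Ser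
(F шS G) i j = sum𝔥 (suc i) λ i₁ → sum𝔥 (suc j) λ j₁ →
                 F i₁ j₁ ш G (i ∸ i₁) (j ∸ j₁)

powS : Ser → ℕ → Ser
powS S zero = cst 𝟙
powS S (suc n) = S *S powS S n

-- 1/(1 - S) = Σ_{n ≥ 0} S^n, for a series S without constant term
-- (then S^n has no monomials of total degree < n, so the coefficient
-- of X^i Y^j only receives contributions from n ≤ i + j).
geom : Ser → Ser
geom S i j = sum𝔥 (suc (i + j)) λ n → powS S n i j

-- Write U i = u g₁ aⁱ and V j = v g₁ aʲ. The coefficient of XⁱYʲ on the left is
-- W i j = U i ш V j, and peeling the trailing letters off with the defining recursion
-- of ш gives, coefficientwise,  W = (F b + (X + Y + ħXY) W) a,  where F, the braced
-- factor, collects the terms produced by the letter b of g₁ (e₁ − g₁ = ħb supplies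
-- ħ (u ш v) b b). On the right, G = 1/(1 − a(X + Y + ħXY)) satisfies
-- G = 1 + (X + Y + ħXY) G a because a commutes with the coefficients of G, so
-- T = F g₁ G obeys the same recursion T = (F b + (X + Y + ħXY) T) a. The recursion
-- determines a series by induction on (i, j), hence W = T.

module Submission where

open import Defs
open import Data.Bool using (Bool; true; false; _∧_; if_then_else_)
open import Data.Bool.Properties using (∧-conicalˡ; ∧-conicalʳ)
open import Data.Nat using (ℕ; zero; suc; _+_; _∸_; _≡ᵇ_; _≤_; _<_; z≤n; s≤s)
import Data.Nat.Properties as ℕₚ
open import Data.Rational using (ℚ; 0ℚ; 1ℚ; -_) renaming (_+_ to _+ℚ_; _*_ to _*ℚ_)
import Data.Rational.Properties as ℚₚ
open import Data.Rational.Solver using (module +-*-Solver)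
open import Data.List using ([]; _∷_; map; concatMap; length)
import Data.List.Properties as Listₚ
open import Data.Product using (_×_; _,_; proj₁; proj₂)
open import Data.Sum as Sum using (_⊎_; inj₁; inj₂)
open import Data.Empty using (⊥-elim)
open import Relation.Binary.PropositionalEquality
open import Level using (0ℓ)
open import Relation.Binary.Bundles using (Setoid)
import Relation.Binary.Reasoning.Setoid as SetoidReasoning
open import Algebra.Bundles using (CommutativeMonoid)
import Algebra.Properties.CommutativeSemigroup as CommutativeSemigroupProperties

open +-*-Solver using (solve; _:=_; _:+_; _:*_; con)

≡ᵇ-refl : ∀ n → (n ≡ᵇ n) ≡ true
≡ᵇ-refl zero = refl
≡ᵇ-refl (suc n) = ≡ᵇ-refl n

≡ᵇ-sound : ∀ m n → (m ≡ᵇ n) ≡ true → m ≡ n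
≡ᵇ-sound zero zero _ = refl
≡ᵇ-sound (suc m) (suc n) e = cong suc (≡ᵇ-sound m n e)

==L-refl : ∀ l → (l ==L l) ≡ true
==L-refl 𝕒 = refl
==L-refl 𝕓 = refl

==L-sound : ∀ l l' → (l ==L l') ≡ true → l ≡ l'
==L-sound 𝕒 𝕒 _ = refl
==L-sound 𝕓 𝕓 _ = refl

==W-refl : ∀ w → (w ==W w) ≡ true
==W-refl ε = refl
==W-refl (w ▸ l) rewrite ==W-refl w = ==L-refl l

==W-sound : ∀ w w' → (w ==W w') ≡ true → w ≡ w'
==W-sound ε ε _ = refl
==W-sound (w ▸ l) (w' ▸ l') e =
  cong₂ _▸_ (==W-sound w w' (∧-conicalˡ _ _ e)) (==L-sound l l' (∧-conicalʳ _ _ e))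

sameKey : ℕ → Word → ℕ → Word → Bool
sameKey k w k' w' = (k ≡ᵇ k') ∧ (w ==W w')

sameKey-refl : ∀ k w → sameKey k w k w ≡ true
sameKey-refl k w rewrite ≡ᵇ-refl k = ==W-refl w

sameKey-sound : ∀ k w k' w' → sameKey k w k' w' ≡ true → k ≡ k' × w ≡ w'
sameKey-sound k w k' w' e = ≡ᵇ-sound k k' (∧-conicalˡ _ _ e) , ==W-sound w w' (∧-conicalʳ _ _ e)

coeff-⊕ : ∀ k w x y → coeff k w (x ⊕ y) ≡ coeff k w x +ℚ coeff k w y
coeff-⊕ k w [] y = sym (ℚₚ.+-identityˡ _)
coeff-⊕ k w ((q , k' , w') ∷ x) y rewrite coeff-⊕ k w x y =
  sym (ℚₚ.+-assoc (if sameKey k w k' w' then q else 0ℚ) (coeff k w x) (coeff k w y))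

linExt : (ℕ → Word → ℚ) → 𝔥 → ℚ
linExt c [] = 0ℚ
linExt c ((q , k , w) ∷ t) = q *ℚ c k w +ℚ linExt c t

deleteKey : ℕ → Word → 𝔥 → 𝔥
deleteKey k w [] = []
deleteKey k w ((q , k' , w') ∷ t) =
  if sameKey k w k' w' then deleteKey k w t else (q , k' , w') ∷ deleteKey k w t

length-deleteKey : ∀ k w x → length (deleteKey k w x) ≤ length x
length-deleteKey k w [] = z≤n
length-deleteKey k w ((q , k' , w') ∷ t) with sameKey k w k' w'
... | true = ℕₚ.m≤n⇒m≤1+n (length-deleteKey k w t)
... | false = s≤s (length-deleteKey k w t)

deleteKey-head : ∀ q k w t → deleteKey k w ((q , k , w) ∷ t) ≡ deleteKey k w t
deleteKey-head q k w t rewrite sameKey-refl k w = refl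

coeff-deleteKey-same : ∀ k w x → coeff k w (deleteKey k w x) ≡ 0ℚ
coeff-deleteKey-same k w [] = refl
coeff-deleteKey-same k w ((q , k' , w') ∷ t) with sameKey k w k' w' in e
... | true = coeff-deleteKey-same k w t
... | false rewrite e = trans (ℚₚ.+-identityˡ _) (coeff-deleteKey-same k w t)

coeff-deleteKey-other : ∀ K W k w x → sameKey K W k w ≡ false →
  coeff K W (deleteKey k w x) ≡ coeff K W x
coeff-deleteKey-other K W k w [] _ = refl
coeff-deleteKey-other K W k w ((q , k' , w') ∷ t) ne with sameKey k w k' w' in e
... | false = cong ((if sameKey K W k' w' then q else 0ℚ) +ℚ_) (coeff-deleteKey-other K W k w t ne)
... | true with sameKey-sound k w k' w' e
...   | refl , refl rewrite ne = trans (coeff-deleteKey-other K W k w t ne) (sym (ℚₚ.+-identityˡ _))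

deleteKey-resp-≈ : ∀ k w x y → x ≈ y → deleteKey k w x ≈ deleteKey k w y
deleteKey-resp-≈ k w x y e K W with sameKey K W k w in s
... | false = trans (coeff-deleteKey-other K W k w x s) (trans (e K W) (sym (coeff-deleteKey-other K W k w y s)))
... | true with sameKey-sound K W k w s
...   | refl , refl = trans (coeff-deleteKey-same k w x) (sym (coeff-deleteKey-same k w y))

linExt-split : ∀ c k w x → linExt c x ≡ coeff k w x *ℚ c k w +ℚ linExt c (deleteKey k w x)
linExt-split c k w [] = sym (trans (ℚₚ.+-identityʳ _) (ℚₚ.*-zeroˡ (c k w)))
linExt-split c k w ((q , k' , w') ∷ t) with sameKey k w k' w' in e
... | true with sameKey-sound k w k' w' e
...   | refl , refl rewrite linExt-split c k w t =
  solve 4 (λ q a b p → q :* a :+ (b :* a :+ p) := (q :+ b) :* a :+ p) refl q (c k w) (coeff k w t) (linExt c (deleteKey k w t))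
linExt-split c k w ((q , k' , w') ∷ t) | false rewrite linExt-split c k w t =
  solve 5 (λ q a b d p → q :* d :+ (b :* a :+ p) := (con 0ℚ :+ b) :* a :+ (q :* d :+ p)) refl
    q (c k w) (coeff k w t) (c k' w') (linExt c (deleteKey k w t))

linExt-resp-≈ : ∀ c x y → x ≈ y → linExt c x ≡ linExt c y
linExt-resp-≈ c x y = bounded (length x + length y) x y ℕₚ.≤-refl
  where
  -- Deleting one key from both lists keeps them ≈-equal and makes them shorter.
  viaKey : ∀ k w x y → x ≈ y →
    linExt c (deleteKey k w x) ≡ linExt c (deleteKey k w y) → linExt c x ≡ linExt c y
  viaKey k w x y e r rewrite linExt-split c k w x | linExt-split c k w y | e k w | r = refl

  bounded : ∀ n x y → length x + length y ≤ n → x ≈ y → linExt c x ≡ linExt c y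
  bounded n [] [] _ _ = refl
  bounded (suc n) ((q , k , w) ∷ x) y (s≤s le) e = viaKey k w ((q , k , w) ∷ x) y e
    (trans (cong (linExt c) (deleteKey-head q k w x))
      (bounded n (deleteKey k w x) (deleteKey k w y)
        (ℕₚ.≤-trans (ℕₚ.+-mono-≤ (length-deleteKey k w x) (length-deleteKey k w y)) le)
        (λ K W → trans (cong (coeff K W) (sym (deleteKey-head q k w x))) (deleteKey-resp-≈ k w ((q , k , w) ∷ x) y e K W))))
  bounded (suc n) [] ((q , k , w) ∷ y) (s≤s le) e = viaKey k w [] ((q , k , w) ∷ y) e
    (trans (bounded n [] (deleteKey k w y) (ℕₚ.≤-trans (length-deleteKey k w y) le)
        (λ K W → trans (deleteKey-resp-≈ k w [] ((q , k , w) ∷ y) e K W) (cong (coeff K W) (deleteKey-head q k w y))))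
      (cong (linExt c) (sym (deleteKey-head q k w y))))

-- _≈_ wrapped in a record, so that both sides of an equation can be inferred from its proof.
infix 4 _≋_
record _≋_ (x y : 𝔥) : Set where
  constructor ≈⇒≋
  field ≋⇒≈ : x ≈ y
open _≋_ public

≋-refl : ∀ {x} → x ≋ x
≋-refl = ≈⇒≋ λ k w → refl

≋-sym : ∀ {x y} → x ≋ y → y ≋ x
≋-sym e = ≈⇒≋ λ k w → sym (≋⇒≈ e k w)

≋-trans : ∀ {x y z} → x ≋ y → y ≋ z → x ≋ z
≋-trans e f = ≈⇒≋ λ k w → trans (≋⇒≈ e k w) (≋⇒≈ f k w)

≡⇒≋ : ∀ {x y} → x ≡ y → x ≋ y
≡⇒≋ refl = ≋-refl

𝔥-setoid : Setoid 0ℓ 0ℓ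
𝔥-setoid = record
  { Carrier = 𝔥 ; _≈_ = _≋_
  ; isEquivalence = record { refl = ≋-refl ; sym = ≋-sym ; trans = ≋-trans } }

⊕-cong : ∀ {x x' y y'} → x ≋ x' → y ≋ y' → x ⊕ y ≋ x' ⊕ y'
⊕-cong {x} {x'} {y} {y'} e f = ≈⇒≋ λ k w →
  trans (coeff-⊕ k w x y) (trans (cong₂ _+ℚ_ (≋⇒≈ e k w) (≋⇒≈ f k w)) (sym (coeff-⊕ k w x' y')))

⊕-comm : ∀ x y → x ⊕ y ≋ y ⊕ x
⊕-comm x y = ≈⇒≋ λ k w →
  trans (coeff-⊕ k w x y) (trans (ℚₚ.+-comm (coeff k w x) (coeff k w y)) (sym (coeff-⊕ k w y x)))

⊕-commutativeMonoid : CommutativeMonoid 0ℓ 0ℓ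
⊕-commutativeMonoid = record
  { Carrier = 𝔥 ; _≈_ = _≋_ ; _∙_ = _⊕_ ; ε = 𝟘
  ; isCommutativeMonoid = record
    { isMonoid = record
      { isSemigroup = record
        { isMagma = record { isEquivalence = Setoid.isEquivalence 𝔥-setoid ; ∙-cong = ⊕-cong }
        ; assoc = λ x y z → ≡⇒≋ (Listₚ.++-assoc x y z) }
      ; identity = (λ x → ≋-refl) , (λ x → ≡⇒≋ (Listₚ.++-identityʳ x)) }
    ; comm = ⊕-comm } }

module ≋-Reasoning = SetoidReasoning 𝔥-setoid

open CommutativeMonoid ⊕-commutativeMonoid public
  using () renaming (assoc to ⊕-assoc; identityˡ to ⊕-identityˡ; identityʳ to ⊕-identityʳ)
open CommutativeSemigroupProperties (CommutativeMonoid.commutativeSemigroup ⊕-commutativeMonoid) public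
  using (xy∙z≈xz∙y; xy∙z≈yz∙x; xy∙z≈yx∙z) renaming (interchange to ⊕-interchange)

-- Linearity of the operations on 𝔥

Linear : (Term → 𝔥) → Set
Linear f = ∀ q k w K W → coeff K W (f (q , k , w)) ≡ q *ℚ coeff K W (f (1ℚ , k , w))

coeff-concatMap : ∀ f → Linear f → ∀ K W x →
  coeff K W (concatMap f x) ≡ linExt (λ k w → coeff K W (f (1ℚ , k , w))) x
coeff-concatMap f lin K W [] = refl
coeff-concatMap f lin K W ((q , k , w) ∷ x) =
  trans (coeff-⊕ K W (f (q , k , w)) (concatMap f x)) (cong₂ _+ℚ_ (lin q k w K W) (coeff-concatMap f lin K W x))

concatMap-resp-≋ : ∀ f → Linear f → ∀ {x y} → x ≋ y → concatMap f x ≋ concatMap f y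
concatMap-resp-≋ f lin {x} {y} e = ≈⇒≋ λ K W →
  trans (coeff-concatMap f lin K W x) (trans (linExt-resp-≈ _ x y (≋⇒≈ e)) (sym (coeff-concatMap f lin K W y)))

map-as-concatMap : ∀ (φ : Term → Term) x → map φ x ≡ concatMap (λ t → φ t ∷ []) x
map-as-concatMap φ x = trans (sym (Listₚ.concatMap-pure (map φ x))) (Listₚ.concatMap-map _ φ x)

map-resp-≋ : ∀ φ → Linear (λ t → φ t ∷ []) → ∀ {x y} → x ≋ y → map φ x ≋ map φ y
map-resp-≋ φ lin {x} {y} e = ≋-trans (≡⇒≋ (map-as-concatMap φ x))
  (≋-trans (concatMap-resp-≋ _ lin e) (≡⇒≋ (sym (map-as-concatMap φ y))))

concatMap-cong-≋ : ∀ (f g : Term → 𝔥) → (∀ t → f t ≋ g t) → ∀ x → concatMap f x ≋ concatMap g x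
concatMap-cong-≋ f g e [] = ≋-refl
concatMap-cong-≋ f g e (t ∷ x) = ⊕-cong (e t) (concatMap-cong-≋ f g e x)

concatMap-⊕ : ∀ (f g : Term → 𝔥) x → concatMap (λ t → f t ⊕ g t) x ≋ concatMap f x ⊕ concatMap g x
concatMap-⊕ f g [] = ≋-refl
concatMap-⊕ f g (t ∷ x) =
  ≋-trans (⊕-cong ≋-refl (concatMap-⊕ f g x)) (⊕-interchange (f t) (g t) (concatMap f x) (concatMap g x))

coeff-map-scale : ∀ (s : ℚ) (g : Term → ℕ × Word) K W z →
  coeff K W (map (λ r → (s *ℚ proj₁ r , g r)) z) ≡ s *ℚ coeff K W (map (λ r → (proj₁ r , g r)) z)
coeff-map-scale s g K W [] = sym (ℚₚ.*-zeroʳ s)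
coeff-map-scale s g K W (r ∷ z) with sameKey K W (proj₁ (g r)) (proj₂ (g r))
... | true rewrite coeff-map-scale s g K W z = sym (ℚₚ.*-distribˡ-+ s (proj₁ r) _)
... | false rewrite coeff-map-scale s g K W z =
  solve 2 (λ s c → con 0ℚ :+ s :* c := s :* (con 0ℚ :+ c)) refl s (coeff K W (map (λ r → (proj₁ r , g r)) z))

select-linear : ∀ b q → (if b then q else 0ℚ) +ℚ 0ℚ ≡ q *ℚ ((if b then 1ℚ else 0ℚ) +ℚ 0ℚ)
select-linear true q = solve 1 (λ q → q :+ con 0ℚ := q :* (con 1ℚ :+ con 0ℚ)) refl q
select-linear false q = solve 1 (λ q → con 0ℚ :+ con 0ℚ := q :* (con 0ℚ :+ con 0ℚ)) refl q

select-linear-scaled : ∀ b a q → (if b then a *ℚ q else 0ℚ) +ℚ 0ℚ ≡ q *ℚ ((if b then a *ℚ 1ℚ else 0ℚ) +ℚ 0ℚ)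
select-linear-scaled true a q = solve 2 (λ a q → a :* q :+ con 0ℚ := q :* (a :* con 1ℚ :+ con 0ℚ)) refl a q
select-linear-scaled false a q = solve 1 (λ q → con 0ℚ :+ con 0ℚ := q :* (con 0ℚ :+ con 0ℚ)) refl q

_⊗ᵀ_ : Term → Term → Term
(q , k , w) ⊗ᵀ (q' , k' , w') = (q *ℚ q' , k + k' , w ·W w')

snocᵀ : Letter → Term → Term
snocᵀ l (q , k , w) = (q , k , w ▸ l)

ħᵀ : Term → Term
ħᵀ (q , k , w) = (q , suc k , w)

◂-cong : ∀ l {x y} → x ≋ y → x ◂ l ≋ y ◂ l
◂-cong l = map-resp-≋ (snocᵀ l) (λ q k w K W → select-linear (sameKey K W k (w ▸ l)) q)

ħ·-cong : ∀ {x y} → x ≋ y → ħ· x ≋ ħ· y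
ħ·-cong = map-resp-≋ ħᵀ (λ q k w K W → select-linear (sameKey K W (suc k) w) q)

⊗-congʳ : ∀ x {y y'} → y ≋ y' → x ⊗ y ≋ x ⊗ y'
⊗-congʳ x e = concatMap-cong-≋ _ _ (λ { (q , k , w) →
  map-resp-≋ _ (λ q' k' w' K W → select-linear-scaled (sameKey K W (k + k') (w ·W w')) q q') e }) x

⊗-congˡ : ∀ {x x'} y → x ≋ x' → x ⊗ y ≋ x' ⊗ y
⊗-congˡ y = concatMap-resp-≋ _ λ q k w K W →
  trans (coeff-map-scale q (λ r → (k + proj₁ (proj₂ r) , w ·W proj₂ (proj₂ r))) K W y)
        (cong (q *ℚ_) (sym (trans (coeff-map-scale 1ℚ (λ r → (k + proj₁ (proj₂ r) , w ·W proj₂ (proj₂ r))) K W y)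
                                  (ℚₚ.*-identityˡ _))))

rescale : Term → Term → Term → Term
rescale (q , k , w) (q' , k' , w') (r , m , v) = (q *ℚ q' *ℚ r , k + k' + m , v)

_шᵀ_ : Term → Term → 𝔥
(q , k , w) шᵀ (q' , k' , w') = map (rescale (q , k , w) (q' , k' , w')) (shW w w')

bilinearExt : (Term → Term → 𝔥) → 𝔥 → 𝔥 → 𝔥
bilinearExt f x y = concatMap (λ t → concatMap (f t) y) x

ш-congˡ : ∀ {x x'} y → x ≋ x' → x ш y ≋ x' ш y
ш-congˡ y = concatMap-resp-≋ (λ t → concatMap (t шᵀ_) y) (λ q k w K W → linear q k w K W y)
  where
  linear : ∀ q k w K W y →
    coeff K W (concatMap ((q , k , w) шᵀ_) y) ≡ q *ℚ coeff K W (concatMap ((1ℚ , k , w) шᵀ_) y)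
  linear q k w K W [] = sym (ℚₚ.*-zeroʳ q)
  linear q k w K W ((q' , k' , w') ∷ y) =
    trans (coeff-⊕ K W ((q , k , w) шᵀ (q' , k' , w')) (concatMap ((q , k , w) шᵀ_) y))
    (trans (cong₂ _+ℚ_ (coeff-map-scale (q *ℚ q') g K W (shW w w')) (linear q k w K W y))
    (trans (solve 4 (λ q q' c r → q :* q' :* c :+ q :* r := q :* (con 1ℚ :* q' :* c :+ r)) refl q q' C R)
    (cong (q *ℚ_) (sym (trans (coeff-⊕ K W ((1ℚ , k , w) шᵀ (q' , k' , w')) (concatMap ((1ℚ , k , w) шᵀ_) y))
       (cong (_+ℚ R) (coeff-map-scale (1ℚ *ℚ q') g K W (shW w w'))))))))
    where
    g : Term → ℕ × Word
    g r = (k + k' + proj₁ (proj₂ r) , proj₂ (proj₂ r))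
    C = coeff K W (map (λ r → (proj₁ r , g r)) (shW w w'))
    R = coeff K W (concatMap ((1ℚ , k , w) шᵀ_) y)

ш-congʳ : ∀ x {y y'} → y ≋ y' → x ш y ≋ x ш y'
ш-congʳ x e = concatMap-cong-≋ _ _ (λ { (q , k , w) → concatMap-resp-≋ ((q , k , w) шᵀ_) (λ q' k' w' K W →
    let g : Term → ℕ × Word
        g r = (k + k' + proj₁ (proj₂ r) , proj₂ (proj₂ r))
    in trans (coeff-map-scale (q *ℚ q') g K W (shW w w'))
       (trans (solve 3 (λ q q' c → q :* q' :* c := q' :* (q :* con 1ℚ :* c)) refl q q'
                 (coeff K W (map (λ r → (proj₁ r , g r)) (shW w w'))))
              (cong (q' *ℚ_) (sym (coeff-map-scale (q *ℚ 1ℚ) g K W (shW w w')))))) e }) x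

·W-identityˡ : ∀ w → ε ·W w ≡ w
·W-identityˡ ε = refl
·W-identityˡ (w ▸ l) = cong (_▸ l) (·W-identityˡ w)

⊗-zeroʳ : ∀ x → x ⊗ 𝟘 ≡ 𝟘
⊗-zeroʳ [] = refl
⊗-zeroʳ (t ∷ x) = ⊗-zeroʳ x

ш-zeroʳ : ∀ x → x ш 𝟘 ≡ 𝟘
ш-zeroʳ [] = refl
ш-zeroʳ (t ∷ x) = ш-zeroʳ x

⊗-distribʳ : ∀ x y z → (x ⊕ y) ⊗ z ≡ x ⊗ z ⊕ y ⊗ z
⊗-distribʳ x y z = Listₚ.concatMap-++ (λ t → map (t ⊗ᵀ_) z) x y

ш-distribʳ : ∀ x y z → (x ⊕ y) ш z ≡ x ш z ⊕ y ш z
ш-distribʳ x y z = Listₚ.concatMap-++ (λ t → concatMap (t шᵀ_) z) x y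

⊗-distribˡ : ∀ x y z → x ⊗ (y ⊕ z) ≋ x ⊗ y ⊕ x ⊗ z
⊗-distribˡ x y z = ≋-trans (≡⇒≋ (Listₚ.concatMap-cong (λ t → Listₚ.map-++ (t ⊗ᵀ_) y z) x))
  (concatMap-⊕ (λ t → map (t ⊗ᵀ_) y) (λ t → map (t ⊗ᵀ_) z) x)

ш-distribˡ : ∀ x y z → x ш (y ⊕ z) ≋ x ш y ⊕ x ш z
ш-distribˡ x y z = ≋-trans (≡⇒≋ (Listₚ.concatMap-cong (λ t → Listₚ.concatMap-++ (t шᵀ_) y z) x))
  (concatMap-⊕ (λ t → concatMap (t шᵀ_) y) (λ t → concatMap (t шᵀ_) z) x)

◂-distrib-⊕ : ∀ x y l → (x ⊕ y) ◂ l ≡ x ◂ l ⊕ y ◂ l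
◂-distrib-⊕ x y l = Listₚ.map-++ (snocᵀ l) x y

◂-distrib-⊕₃ : ∀ x y z l → (x ⊕ y ⊕ z) ◂ l ≡ x ◂ l ⊕ y ◂ l ⊕ z ◂ l
◂-distrib-⊕₃ x y z l = trans (◂-distrib-⊕ (x ⊕ y) z l) (cong (_⊕ z ◂ l) (◂-distrib-⊕ x y l))

ħ·-distrib-⊕ : ∀ x y → ħ· (x ⊕ y) ≡ ħ· x ⊕ ħ· y
ħ·-distrib-⊕ x y = Listₚ.map-++ ħᵀ x y

ħ·-◂ : ∀ x l → ħ· (x ◂ l) ≡ ħ· x ◂ l
ħ·-◂ x l = trans (sym (Listₚ.map-∘ x)) (Listₚ.map-∘ x)

⊗-◂ : ∀ x y l → x ⊗ (y ◂ l) ≡ (x ⊗ y) ◂ l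
⊗-◂ x y l = trans (Listₚ.concatMap-cong (λ t → trans (sym (Listₚ.map-∘ y)) (Listₚ.map-∘ y)) x)
  (sym (Listₚ.map-concatMap (snocᵀ l) (λ t → map (t ⊗ᵀ_) y) x))

⊗-ħ·ʳ : ∀ x y → x ⊗ ħ· y ≡ ħ· (x ⊗ y)
⊗-ħ·ʳ x y = trans (Listₚ.concatMap-cong (λ t → trans (sym (Listₚ.map-∘ y))
     (trans (Listₚ.map-cong (⊗ᵀ-ħᵀ t) y) (Listₚ.map-∘ y))) x)
  (sym (Listₚ.map-concatMap ħᵀ (λ t → map (t ⊗ᵀ_) y) x))
  where
  ⊗ᵀ-ħᵀ : ∀ t t' → t ⊗ᵀ ħᵀ t' ≡ ħᵀ (t ⊗ᵀ t')
  ⊗ᵀ-ħᵀ (q , k , w) (q' , k' , w') = cong (λ n → (q *ℚ q' , n , w ·W w')) (ℕₚ.+-suc k k')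

ħ·-⊗ˡ : ∀ x y → ħ· x ⊗ y ≡ ħ· (x ⊗ y)
ħ·-⊗ˡ x y = trans (Listₚ.concatMap-map (λ t → map (t ⊗ᵀ_) y) ħᵀ x)
  (trans (Listₚ.concatMap-cong (λ t → Listₚ.map-∘ y) x)
  (sym (Listₚ.map-concatMap ħᵀ (λ t → map (t ⊗ᵀ_) y) x)))

_◂*_ : 𝔥 → Word → 𝔥
x ◂* w = map (λ { (q , k , v) → (q , k , v ·W w) }) x

⊗-word : ∀ x w → x ⊗ word w ≡ x ◂* w
⊗-word [] w = refl
⊗-word ((q , k , v) ∷ x) w =
  cong₂ _∷_ (cong₂ (λ a b → (a , b , v ·W w)) (ℚₚ.*-identityʳ q) (ℕₚ.+-identityʳ k)) (⊗-word x w)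

◂*-▸ : ∀ x w l → x ◂* (w ▸ l) ≡ (x ◂* w) ◂ l
◂*-▸ x w l = Listₚ.map-∘ x

◂*-ε : ∀ x → x ◂* ε ≡ x
◂*-ε x = Listₚ.map-id x

ħ-⊗ : ∀ y → ħ ⊗ y ≡ ħ· y
ħ-⊗ y = trans (Listₚ.++-identityʳ _) (Listₚ.map-cong ħ⊗ᵀ y)
  where
  ħ⊗ᵀ : ∀ t → (1ℚ , 1 , ε) ⊗ᵀ t ≡ ħᵀ t
  ħ⊗ᵀ (q , k , w) = cong₂ (λ a b → (a , suc k , b)) (ℚₚ.*-identityˡ q) (·W-identityˡ w)

⊗-identityˡ : ∀ y → 𝟙 ⊗ y ≡ y
⊗-identityˡ y = trans (Listₚ.++-identityʳ _) (trans (Listₚ.map-cong 𝟙⊗ᵀ y) (Listₚ.map-id y))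
  where
  𝟙⊗ᵀ : ∀ t → (1ℚ , 0 , ε) ⊗ᵀ t ≡ t
  𝟙⊗ᵀ (q , k , w) = cong₂ (λ a b → (a , k , b)) (ℚₚ.*-identityˡ q) (·W-identityˡ w)

⊗-identityʳ : ∀ x → x ⊗ 𝟙 ≡ x
⊗-identityʳ x = trans (⊗-word x ε) (◂*-ε x)

⊗-g₁ : ∀ x → x ⊗ g₁ ≡ (x ◂ 𝕓) ◂ 𝕒
⊗-g₁ x = trans (⊗-word x (ε ▸ 𝕓 ▸ 𝕒)) (trans (◂*-▸ x (ε ▸ 𝕓) 𝕒)
  (cong (_◂ 𝕒) (trans (◂*-▸ x ε 𝕓) (cong (_◂ 𝕓) (◂*-ε x)))))

-- The shuffle recursions

shW-ε : ∀ w → shW w ε ≡ word w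
shW-ε ε = refl
shW-ε (w ▸ l) = refl

shW-▸𝕓ˡ : ∀ w w' → shW (w ▸ 𝕓) w' ≡ shW w w' ◂ 𝕓
shW-▸𝕓ˡ w ε rewrite shW-ε w = refl
shW-▸𝕓ˡ w (w' ▸ l) = refl

shW-▸𝕓ʳ : ∀ w w' → shW w (w' ▸ 𝕓) ≡ shW w w' ◂ 𝕓
shW-▸𝕓ʳ ε w' = refl
shW-▸𝕓ʳ (w ▸ 𝕓) w' = trans (cong (_◂ 𝕓) (shW-▸𝕓ʳ w w')) (cong (_◂ 𝕓) (sym (shW-▸𝕓ˡ w w')))
shW-▸𝕓ʳ (w ▸ 𝕒) w' = refl

rescale-◂ : ∀ t t' l z → map (rescale t t') (z ◂ l) ≡ map (rescale t t') z ◂ l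
rescale-◂ (q , k , w) (q' , k' , w') l z = trans (sym (Listₚ.map-∘ z)) (Listₚ.map-∘ z)

bilinearExt-cong : ∀ (f g : Term → Term → 𝔥) → (∀ t t' → f t t' ≡ g t t') → ∀ x y →
  bilinearExt f x y ≡ bilinearExt g x y
bilinearExt-cong f g e x y = Listₚ.concatMap-cong (λ t → Listₚ.concatMap-cong (e t) y) x

bilinearExt-◂ : ∀ (f : Term → Term → 𝔥) l x y →
  bilinearExt (λ t t' → f t t' ◂ l) x y ≡ bilinearExt f x y ◂ l
bilinearExt-◂ f l x y = trans (Listₚ.concatMap-cong (λ t → sym (Listₚ.map-concatMap (snocᵀ l) (f t) y)) x)
  (sym (Listₚ.map-concatMap (snocᵀ l) (λ t → concatMap (f t) y) x))

bilinearExt-ħ· : ∀ (f : Term → Term → 𝔥) x y → bilinearExt (λ t t' → ħ· (f t t')) x y ≡ ħ· (bilinearExt f x y)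
bilinearExt-ħ· f x y = trans (Listₚ.concatMap-cong (λ t → sym (Listₚ.map-concatMap ħᵀ (f t) y)) x)
  (sym (Listₚ.map-concatMap ħᵀ (λ t → concatMap (f t) y) x))

bilinearExt-⊕₃ : ∀ (f g h : Term → Term → 𝔥) x y →
  bilinearExt (λ t t' → f t t' ⊕ g t t' ⊕ h t t') x y ≋ bilinearExt f x y ⊕ bilinearExt g x y ⊕ bilinearExt h x y
bilinearExt-⊕₃ f g h x y =
  ≋-trans (concatMap-cong-≋ _ _ (λ t → ≋-trans (concatMap-⊕ (λ t' → f t t' ⊕ g t t') (h t) y)
                                                 (⊕-cong (concatMap-⊕ (f t) (g t) y) ≋-refl)) x)
  (≋-trans (concatMap-⊕ (λ t → concatMap (f t) y ⊕ concatMap (g t) y) (λ t → concatMap (h t) y) x)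
    (⊕-cong (concatMap-⊕ (λ t → concatMap (f t) y) (λ t → concatMap (g t) y) x) ≋-refl))

ш-◂𝕓ˡ : ∀ x y → (x ◂ 𝕓) ш y ≡ (x ш y) ◂ 𝕓
ш-◂𝕓ˡ x y = trans (Listₚ.concatMap-map (λ t → concatMap (t шᵀ_) y) (snocᵀ 𝕓) x)
  (trans (bilinearExt-cong _ (λ t t' → (t шᵀ t') ◂ 𝕓) шᵀ-◂𝕓ˡ x y) (bilinearExt-◂ _шᵀ_ 𝕓 x y))
  where
  шᵀ-◂𝕓ˡ : ∀ t t' → snocᵀ 𝕓 t шᵀ t' ≡ (t шᵀ t') ◂ 𝕓
  шᵀ-◂𝕓ˡ (q , k , w) (q' , k' , w') =
    trans (cong (map (rescale (q , k , w) (q' , k' , w'))) (shW-▸𝕓ˡ w w')) (rescale-◂ (q , k , w) (q' , k' , w') 𝕓 (shW w w'))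

ш-◂𝕓ʳ : ∀ x y → x ш (y ◂ 𝕓) ≡ (x ш y) ◂ 𝕓
ш-◂𝕓ʳ x y = trans (Listₚ.concatMap-cong (λ t → Listₚ.concatMap-map (t шᵀ_) (snocᵀ 𝕓) y) x)
  (trans (bilinearExt-cong _ (λ t t' → (t шᵀ t') ◂ 𝕓) шᵀ-◂𝕓ʳ x y) (bilinearExt-◂ _шᵀ_ 𝕓 x y))
  where
  шᵀ-◂𝕓ʳ : ∀ t t' → t шᵀ snocᵀ 𝕓 t' ≡ (t шᵀ t') ◂ 𝕓
  шᵀ-◂𝕓ʳ (q , k , w) (q' , k' , w') =
    trans (cong (map (rescale (q , k , w) (q' , k' , w'))) (shW-▸𝕓ʳ w w')) (rescale-◂ (q , k , w) (q' , k' , w') 𝕓 (shW w w'))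

ш-◂𝕒 : ∀ x y → (x ◂ 𝕒) ш (y ◂ 𝕒) ≋ ((x ◂ 𝕒) ш y ⊕ x ш (y ◂ 𝕒) ⊕ ħ· (x ш y)) ◂ 𝕒
ш-◂𝕒 x y = ≋-trans (≡⇒≋ (trans (Listₚ.concatMap-map (λ t → concatMap (t шᵀ_) (y ◂ 𝕒)) (snocᵀ 𝕒) x)
                         (trans (Listₚ.concatMap-cong (λ t → Listₚ.concatMap-map (snocᵀ 𝕒 t шᵀ_) (snocᵀ 𝕒) y) x)
                         (trans (bilinearExt-cong _ _ шᵀ-◂𝕒 x y) (bilinearExt-◂ _ 𝕒 x y)))))
  (◂-cong 𝕒 (≋-trans (bilinearExt-⊕₃ leftA rightA (λ t t' → ħ· (t шᵀ t')) x y)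
     (⊕-cong (⊕-cong (≡⇒≋ (sym (Listₚ.concatMap-map (λ t → concatMap (t шᵀ_) y) (snocᵀ 𝕒) x)))
                     (≡⇒≋ (sym (Listₚ.concatMap-cong (λ t → Listₚ.concatMap-map (t шᵀ_) (snocᵀ 𝕒) y) x))))
             (≡⇒≋ (bilinearExt-ħ· _шᵀ_ x y)))))
  where
  leftA rightA : Term → Term → 𝔥
  leftA t t' = snocᵀ 𝕒 t шᵀ t'
  rightA t t' = t шᵀ snocᵀ 𝕒 t'
  шᵀ-◂𝕒 : ∀ t t' → snocᵀ 𝕒 t шᵀ snocᵀ 𝕒 t' ≡ (leftA t t' ⊕ rightA t t' ⊕ ħ· (t шᵀ t')) ◂ 𝕒
  шᵀ-◂𝕒 (q , k , w) (q' , k' , w') =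
    trans (rescale-◂ (q , k , w) (q' , k' , w') 𝕒 _)
    (cong (_◂ 𝕒) (trans (Listₚ.map-++ ρ (shW (w ▸ 𝕒) w' ⊕ shW w (w' ▸ 𝕒)) _)
      (cong₂ _⊕_ (Listₚ.map-++ ρ (shW (w ▸ 𝕒) w') (shW w (w' ▸ 𝕒)))
        (trans (sym (Listₚ.map-∘ (shW w w')))
          (trans (Listₚ.map-cong ρ-ħᵀ (shW w w')) (Listₚ.map-∘ (shW w w')))))))
    where
    ρ = rescale (q , k , w) (q' , k' , w')
    ρ-ħᵀ : ∀ r → ρ (ħᵀ r) ≡ ħᵀ (ρ r)
    ρ-ħᵀ (r , m , v) = cong (λ n → (q *ℚ q' *ℚ r , n , v)) (ℕₚ.+-suc (k + k') m)

-- Finite sums and convolution of series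

sum𝔥-cong : ∀ n {f g : ℕ → 𝔥} → (∀ k → k < n → f k ≋ g k) → sum𝔥 n f ≋ sum𝔥 n g
sum𝔥-cong zero e = ≋-refl
sum𝔥-cong (suc n) e = ⊕-cong (sum𝔥-cong n (λ k lt → e k (ℕₚ.m≤n⇒m≤1+n lt))) (e n ℕₚ.≤-refl)

sum𝔥-zero : ∀ n {f : ℕ → 𝔥} → (∀ k → k < n → f k ≋ 𝟘) → sum𝔥 n f ≋ 𝟘
sum𝔥-zero zero e = ≋-refl
sum𝔥-zero (suc n) e = ⊕-cong (sum𝔥-zero n (λ k lt → e k (ℕₚ.m≤n⇒m≤1+n lt))) (e n ℕₚ.≤-refl)

sum𝔥-first : ∀ n (f : ℕ → 𝔥) → sum𝔥 (suc n) f ≋ f 0 ⊕ sum𝔥 n (λ k → f (suc k))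
sum𝔥-first zero f = ≋-sym (⊕-identityʳ (f 0))
sum𝔥-first (suc n) f = ≋-trans (⊕-cong (sum𝔥-first n f) ≋-refl) (⊕-assoc (f 0) _ _)

sum𝔥-only-first : ∀ n (f : ℕ → 𝔥) → (∀ k → f (suc k) ≋ 𝟘) → sum𝔥 (suc n) f ≋ f 0
sum𝔥-only-first n f e =
  ≋-trans (sum𝔥-first n f) (≋-trans (⊕-cong ≋-refl (sum𝔥-zero n (λ k _ → e k))) (⊕-identityʳ (f 0)))

sum𝔥-only-last : ∀ n (f : ℕ → 𝔥) → (∀ k → k < n → f k ≋ 𝟘) → sum𝔥 (suc n) f ≋ f n
sum𝔥-only-last n f e = ⊕-cong (sum𝔥-zero n e) ≋-refl

sum𝔥-⊕ : ∀ n (f g : ℕ → 𝔥) → sum𝔥 n (λ k → f k ⊕ g k) ≋ sum𝔥 n f ⊕ sum𝔥 n g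
sum𝔥-⊕ zero f g = ≋-refl
sum𝔥-⊕ (suc n) f g =
  ≋-trans (⊕-cong (sum𝔥-⊕ n f g) ≋-refl) (⊕-interchange (sum𝔥 n f) (sum𝔥 n g) (f n) (g n))

sum𝔥-◂ : ∀ n (f : ℕ → 𝔥) l → sum𝔥 n (λ k → f k ◂ l) ≡ sum𝔥 n f ◂ l
sum𝔥-◂ zero f l = refl
sum𝔥-◂ (suc n) f l = trans (cong (_⊕ (f n ◂ l)) (sum𝔥-◂ n f l)) (sym (◂-distrib-⊕ (sum𝔥 n f) (f n) l))

sum𝔥-ħ· : ∀ n (f : ℕ → 𝔥) → sum𝔥 n (λ k → ħ· (f k)) ≡ ħ· (sum𝔥 n f)
sum𝔥-ħ· zero f = refl
sum𝔥-ħ· (suc n) f = trans (cong (_⊕ ħ· (f n)) (sum𝔥-ħ· n f)) (sym (ħ·-distrib-⊕ (sum𝔥 n f) (f n)))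

⊗-sum𝔥 : ∀ c n (f : ℕ → 𝔥) → c ⊗ sum𝔥 n f ≋ sum𝔥 n (λ k → c ⊗ f k)
⊗-sum𝔥 c zero f = ≡⇒≋ (⊗-zeroʳ c)
⊗-sum𝔥 c (suc n) f = ≋-trans (⊗-distribˡ c (sum𝔥 n f) (f n)) (⊕-cong (⊗-sum𝔥 c n f) ≋-refl)

antidiag : ℕ → (ℕ → ℕ → 𝔥) → 𝔥
antidiag n f = sum𝔥 (suc n) λ k → f k (n ∸ k)

antidiag-shiftˡ : ∀ n (f : ℕ → ℕ → 𝔥) → (∀ m → f 0 m ≋ 𝟘) →
  antidiag (suc n) f ≋ antidiag n (λ k → f (suc k))
antidiag-shiftˡ n f e =
  ≋-trans (sum𝔥-first (suc n) (λ k → f k (suc n ∸ k))) (≋-trans (⊕-cong (e (suc n)) ≋-refl) (⊕-identityˡ _))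

antidiag-shiftʳ : ∀ n (f : ℕ → ℕ → 𝔥) → (∀ k → f k 0 ≋ 𝟘) →
  antidiag (suc n) f ≋ antidiag n (λ k m → f k (suc m))
antidiag-shiftʳ n f e =
  ≋-trans (⊕-cong ≋-refl (≋-trans (≡⇒≋ (cong (f (suc n)) (ℕₚ.n∸n≡0 n))) (e (suc n))))
  (≋-trans (⊕-identityʳ _) (sum𝔥-cong (suc n) (λ k lt → ≡⇒≋ (cong (f k) (ℕₚ.+-∸-assoc 1 (ℕₚ.≤-pred lt))))))

antidiag-onlyˡ : ∀ n (f : ℕ → ℕ → 𝔥) → (∀ k m → f (suc k) m ≋ 𝟘) → antidiag n f ≋ f 0 n
antidiag-onlyˡ n f e = sum𝔥-only-first n (λ k → f k (n ∸ k)) (λ k → e k (n ∸ suc k))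

antidiag-onlyʳ : ∀ n (f : ℕ → ℕ → 𝔥) → (∀ k m → f k (suc m) ≋ 𝟘) → antidiag n f ≋ f n 0
antidiag-onlyʳ n f e =
  ≋-trans (sum𝔥-only-last n (λ k → f k (n ∸ k)) earlier) (≡⇒≋ (cong (f n) (ℕₚ.n∸n≡0 n)))
  where
  earlier : ∀ k → k < n → f k (n ∸ k) ≋ 𝟘
  earlier k (s≤s le) = ≋-trans (≡⇒≋ (cong (f k) (ℕₚ.+-∸-assoc 1 le))) (e k _)

conv : (𝔥 → 𝔥 → 𝔥) → Ser → Ser → Ser
conv op F G i j = antidiag i λ i₁ i₂ → antidiag j λ j₁ j₂ → op (F i₁ j₁) (G i₂ j₂)

-- timesX H and timesY H are the coefficient arrays of X·H and Y·H.
timesX timesY : Ser → Ser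
timesX H zero j = 𝟘
timesX H (suc i) j = H i j
timesY H i zero = 𝟘
timesY H i (suc j) = H i j

alongX alongY : (ℕ → 𝔥) → Ser
alongX f i zero = f i
alongX f i (suc j) = 𝟘
alongY f zero j = f j
alongY f (suc i) j = 𝟘

infix 4 _≋S_
_≋S_ : Ser → Ser → Set
F ≋S G = ∀ i j → F i j ≋ G i j

timesX-cong : ∀ {F G} → F ≋S G → timesX F ≋S timesX G
timesX-cong e zero j = ≋-refl
timesX-cong e (suc i) j = e i j

timesY-cong : ∀ {F G} → F ≋S G → timesY F ≋S timesY G
timesY-cong e i zero = ≋-refl
timesY-cong e i (suc j) = e i j

record IsBilinear (op : 𝔥 → 𝔥 → 𝔥) : Set where
  field
    congˡ : ∀ {x x'} y → x ≋ x' → op x y ≋ op x' y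
    congʳ : ∀ x {y y'} → y ≋ y' → op x y ≋ op x y'
    zeroˡ : ∀ y → op 𝟘 y ≋ 𝟘
    zeroʳ : ∀ x → op x 𝟘 ≋ 𝟘
    distribˡ : ∀ x y z → op x (y ⊕ z) ≋ op x y ⊕ op x z
    distribʳ : ∀ x y z → op (x ⊕ y) z ≋ op x z ⊕ op y z

module Convolution {op : 𝔥 → 𝔥 → 𝔥} (bilinear : IsBilinear op) where
  open IsBilinear bilinear

  conv-congˡ : ∀ {F F'} G → F ≋S F' → conv op F G ≋S conv op F' G
  conv-congˡ G e i j = sum𝔥-cong (suc i) (λ i₁ _ → sum𝔥-cong (suc j) (λ j₁ _ → congˡ _ (e i₁ j₁)))

  conv-congʳ : ∀ F {G G'} → G ≋S G' → conv op F G ≋S conv op F G'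
  conv-congʳ F e i j = sum𝔥-cong (suc i) (λ i₁ _ → sum𝔥-cong (suc j) (λ j₁ _ → congʳ _ (e _ _)))

  conv-distribʳ : ∀ F F' G i j → conv op (λ a b → F a b ⊕ F' a b) G i j ≋ conv op F G i j ⊕ conv op F' G i j
  conv-distribʳ F F' G i j =
    ≋-trans (sum𝔥-cong (suc i) (λ i₁ _ → ≋-trans (sum𝔥-cong (suc j) (λ j₁ _ → distribʳ _ _ _))
      (sum𝔥-⊕ (suc j) (λ j₁ → op (F i₁ j₁) (G (i ∸ i₁) (j ∸ j₁))) (λ j₁ → op (F' i₁ j₁) (G (i ∸ i₁) (j ∸ j₁))))))
    (sum𝔥-⊕ (suc i) (λ i₁ → antidiag j λ j₁ j₂ → op (F i₁ j₁) (G (i ∸ i₁) j₂))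
                    (λ i₁ → antidiag j λ j₁ j₂ → op (F' i₁ j₁) (G (i ∸ i₁) j₂)))

  conv-distribˡ : ∀ F G G' i j → conv op F (λ a b → G a b ⊕ G' a b) i j ≋ conv op F G i j ⊕ conv op F G' i j
  conv-distribˡ F G G' i j =
    ≋-trans (sum𝔥-cong (suc i) (λ i₁ _ → ≋-trans (sum𝔥-cong (suc j) (λ j₁ _ → distribˡ _ _ _))
      (sum𝔥-⊕ (suc j) (λ j₁ → op (F i₁ j₁) (G (i ∸ i₁) (j ∸ j₁))) (λ j₁ → op (F i₁ j₁) (G' (i ∸ i₁) (j ∸ j₁))))))
    (sum𝔥-⊕ (suc i) (λ i₁ → antidiag j λ j₁ j₂ → op (F i₁ j₁) (G (i ∸ i₁) j₂))
                    (λ i₁ → antidiag j λ j₁ j₂ → op (F i₁ j₁) (G' (i ∸ i₁) j₂)))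

  conv-cstˡ : ∀ c G i j → conv op (cst c) G i j ≋ op c (G i j)
  conv-cstˡ c G i j =
    ≋-trans (antidiag-onlyˡ i (λ i₁ i₂ → antidiag j λ j₁ j₂ → op (cst c i₁ j₁) (G i₂ j₂))
               (λ k m → sum𝔥-zero (suc j) (λ j₁ _ → zeroˡ _)))
            (antidiag-onlyˡ j (λ j₁ j₂ → op (cst c 0 j₁) (G i j₂)) (λ k m → zeroˡ _))

  conv-cstʳ : ∀ F c i j → conv op F (cst c) i j ≋ op (F i j) c
  conv-cstʳ F c i j =
    ≋-trans (antidiag-onlyʳ i (λ i₁ i₂ → antidiag j λ j₁ j₂ → op (F i₁ j₁) (cst c i₂ j₂))
               (λ k m → sum𝔥-zero (suc j) (λ j₁ _ → zeroʳ _)))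
            (antidiag-onlyʳ j (λ j₁ j₂ → op (F i j₁) (cst c 0 j₂)) (λ k m → zeroʳ _))

  conv-timesXˡ : ∀ F G → conv op (timesX F) G ≋S timesX (conv op F G)
  conv-timesXˡ F G zero j = sum𝔥-zero (suc j) (λ j₁ _ → zeroˡ _)
  conv-timesXˡ F G (suc i) j = antidiag-shiftˡ i (λ i₁ i₂ → antidiag j λ j₁ j₂ → op (timesX F i₁ j₁) (G i₂ j₂))
    (λ m → sum𝔥-zero (suc j) (λ j₁ _ → zeroˡ _))

  conv-timesXʳ : ∀ F G → conv op F (timesX G) ≋S timesX (conv op F G)
  conv-timesXʳ F G zero j = sum𝔥-zero (suc j) (λ j₁ _ → zeroʳ _)
  conv-timesXʳ F G (suc i) j = antidiag-shiftʳ i (λ i₁ i₂ → antidiag j λ j₁ j₂ → op (F i₁ j₁) (timesX G i₂ j₂))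
    (λ k → sum𝔥-zero (suc j) (λ j₁ _ → zeroʳ _))

  conv-timesYˡ : ∀ F G → conv op (timesY F) G ≋S timesY (conv op F G)
  conv-timesYˡ F G i zero = sum𝔥-zero (suc i) (λ i₁ _ → zeroˡ _)
  conv-timesYˡ F G i (suc j) = sum𝔥-cong (suc i) (λ i₁ _ → antidiag-shiftˡ j (λ j₁ j₂ → op (timesY F i₁ j₁) (G (i ∸ i₁) j₂)) (λ m → zeroˡ _))

  conv-timesYʳ : ∀ F G → conv op F (timesY G) ≋S timesY (conv op F G)
  conv-timesYʳ F G i zero = sum𝔥-zero (suc i) (λ i₁ _ → zeroʳ _)
  conv-timesYʳ F G i (suc j) = sum𝔥-cong (suc i) (λ i₁ _ → antidiag-shiftʳ j (λ j₁ j₂ → op (F i₁ j₁) (timesY G (i ∸ i₁) j₂)) (λ k → zeroʳ _))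

  conv-alongX-alongY : ∀ f g i j → conv op (alongX f) (alongY g) i j ≋ op (f i) (g j)
  conv-alongX-alongY f g i j =
    ≋-trans (antidiag-onlyʳ i (λ i₁ i₂ → antidiag j λ j₁ j₂ → op (alongX f i₁ j₁) (alongY g i₂ j₂))
               (λ k m → sum𝔥-zero (suc j) (λ j₁ _ → zeroʳ _)))
            (antidiag-onlyˡ j (λ j₁ j₂ → op (alongX f i j₁) (alongY g 0 j₂)) (λ k m → zeroˡ _))

⊗-isBilinear : IsBilinear _⊗_
⊗-isBilinear = record
  { congˡ = ⊗-congˡ ; congʳ = ⊗-congʳ ; zeroˡ = λ y → ≋-refl ; zeroʳ = λ x → ≡⇒≋ (⊗-zeroʳ x)
  ; distribˡ = ⊗-distribˡ ; distribʳ = λ x y z → ≡⇒≋ (⊗-distribʳ x y z) }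

ш-isBilinear : IsBilinear _ш_
ш-isBilinear = record
  { congˡ = ш-congˡ ; congʳ = ш-congʳ ; zeroˡ = λ y → ≋-refl ; zeroʳ = λ x → ≡⇒≋ (ш-zeroʳ x)
  ; distribˡ = ш-distribˡ ; distribʳ = λ x y z → ≡⇒≋ (ш-distribʳ x y z) }

module Conv⊗ = Convolution ⊗-isBilinear
module Convш = Convolution ш-isBilinear

*S-◂ʳ : ∀ F G l i j → (F *S (λ a b → G a b ◂ l)) i j ≋ (F *S G) i j ◂ l
*S-◂ʳ F G l i j =
  ≋-trans (sum𝔥-cong (suc i) (λ i₁ _ →
     ≋-trans (sum𝔥-cong (suc j) (λ j₁ _ → ≡⇒≋ (⊗-◂ (F i₁ j₁) (G (i ∸ i₁) (j ∸ j₁)) l)))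
             (≡⇒≋ (sum𝔥-◂ (suc j) (λ j₁ → F i₁ j₁ ⊗ G (i ∸ i₁) (j ∸ j₁)) l))))
  (≡⇒≋ (sum𝔥-◂ (suc i) (λ i₁ → antidiag j λ j₁ j₂ → F i₁ j₁ ⊗ G (i ∸ i₁) j₂) l))

*S-ħ·ʳ : ∀ F G i j → (F *S (λ a b → ħ· (G a b))) i j ≋ ħ· ((F *S G) i j)
*S-ħ·ʳ F G i j =
  ≋-trans (sum𝔥-cong (suc i) (λ i₁ _ →
     ≋-trans (sum𝔥-cong (suc j) (λ j₁ _ → ≡⇒≋ (⊗-ħ·ʳ (F i₁ j₁) (G (i ∸ i₁) (j ∸ j₁)))))
             (≡⇒≋ (sum𝔥-ħ· (suc j) (λ j₁ → F i₁ j₁ ⊗ G (i ∸ i₁) (j ∸ j₁))))))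
  (≡⇒≋ (sum𝔥-ħ· (suc i) (λ i₁ → antidiag j λ j₁ j₂ → F i₁ j₁ ⊗ G (i ∸ i₁) j₂)))

⊗-cst𝟙 : ∀ c i j → c ⊗ cst 𝟙 i j ≋ cst c i j
⊗-cst𝟙 c zero zero = ≡⇒≋ (⊗-identityʳ c)
⊗-cst𝟙 c zero (suc j) = ≡⇒≋ (⊗-zeroʳ c)
⊗-cst𝟙 c (suc i) j = ≡⇒≋ (⊗-zeroʳ c)

⊗-timesX : ∀ c H i j → c ⊗ timesX H i j ≋ timesX (λ a b → c ⊗ H a b) i j
⊗-timesX c H zero j = ≡⇒≋ (⊗-zeroʳ c)
⊗-timesX c H (suc i) j = ≋-refl

⊗-timesY : ∀ c H i j → c ⊗ timesY H i j ≋ timesY (λ a b → c ⊗ H a b) i j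
⊗-timesY c H i zero = ≡⇒≋ (⊗-zeroʳ c)
⊗-timesY c H i (suc j) = ≋-refl

Xs≡timesX-𝟙 : ∀ i j → Xs i j ≡ timesX (cst 𝟙) i j
Xs≡timesX-𝟙 zero j = refl
Xs≡timesX-𝟙 (suc zero) zero = refl
Xs≡timesX-𝟙 (suc zero) (suc j) = refl
Xs≡timesX-𝟙 (suc (suc i)) j = refl

Ys≡timesY-𝟙 : ∀ i j → Ys i j ≡ timesY (cst 𝟙) i j
Ys≡timesY-𝟙 zero zero = refl
Ys≡timesY-𝟙 (suc i) zero = refl
Ys≡timesY-𝟙 zero (suc zero) = refl
Ys≡timesY-𝟙 (suc i) (suc zero) = refl
Ys≡timesY-𝟙 zero (suc (suc j)) = refl
Ys≡timesY-𝟙 (suc i) (suc (suc j)) = refl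

⊗-Xs : ∀ c i j → c ⊗ Xs i j ≋ timesX (cst c) i j
⊗-Xs c i j = ≋-trans (≡⇒≋ (cong (c ⊗_) (Xs≡timesX-𝟙 i j)))
  (≋-trans (⊗-timesX c (cst 𝟙) i j) (timesX-cong (⊗-cst𝟙 c) i j))

⊗-Ys : ∀ c i j → c ⊗ Ys i j ≋ timesY (cst c) i j
⊗-Ys c i j = ≋-trans (≡⇒≋ (cong (c ⊗_) (Ys≡timesY-𝟙 i j)))
  (≋-trans (⊗-timesY c (cst 𝟙) i j) (timesY-cong (⊗-cst𝟙 c) i j))

cst-*S-Xs : ∀ c → cst c *S Xs ≋S timesX (cst c)
cst-*S-Xs c i j = ≋-trans (Conv⊗.conv-cstˡ c Xs i j) (⊗-Xs c i j)

cst-*S-Ys : ∀ c → cst c *S Ys ≋S timesY (cst c)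
cst-*S-Ys c i j = ≋-trans (Conv⊗.conv-cstˡ c Ys i j) (⊗-Ys c i j)

aWord : ℕ → Word
aWord zero = ε
aWord (suc n) = aWord n ▸ 𝕒

a⊗aWord : ∀ n → letter-a ⊗ word (aWord n) ≡ word (aWord (suc n))
a⊗aWord n = trans (⊗-word letter-a (aWord n)) (cong word (a·aWord n))
  where
  a·aWord : ∀ n → (ε ▸ 𝕒) ·W aWord n ≡ aWord (suc n)
  a·aWord zero = refl
  a·aWord (suc n) = cong (_▸ 𝕒) (a·aWord n)

powAX powAY : ℕ → Ser
powAX = powS (cst letter-a *S Xs)
powAY = powS (cst letter-a *S Ys)

powAX-suc : ∀ n → powAX (suc n) ≋S timesX (λ a b → letter-a ⊗ powAX n a b)
powAX-suc n i j = ≋-trans (Conv⊗.conv-congˡ (powAX n) (cst-*S-Xs letter-a) i j)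
  (≋-trans (Conv⊗.conv-timesXˡ (cst letter-a) (powAX n) i j)
           (timesX-cong (Conv⊗.conv-cstˡ letter-a (powAX n)) i j))

powAY-suc : ∀ n → powAY (suc n) ≋S timesY (λ a b → letter-a ⊗ powAY n a b)
powAY-suc n i j = ≋-trans (Conv⊗.conv-congˡ (powAY n) (cst-*S-Ys letter-a) i j)
  (≋-trans (Conv⊗.conv-timesYˡ (cst letter-a) (powAY n) i j)
           (timesY-cong (Conv⊗.conv-cstˡ letter-a (powAY n)) i j))

powAX-diagonal : ∀ n → powAX n n 0 ≋ word (aWord n)
powAX-diagonal zero = ≋-refl
powAX-diagonal (suc n) =
  ≋-trans (powAX-suc n (suc n) 0) (≋-trans (⊗-congʳ letter-a (powAX-diagonal n)) (≡⇒≋ (a⊗aWord n)))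

powAY-diagonal : ∀ n → powAY n 0 n ≋ word (aWord n)
powAY-diagonal zero = ≋-refl
powAY-diagonal (suc n) =
  ≋-trans (powAY-suc n 0 (suc n)) (≋-trans (⊗-congʳ letter-a (powAY-diagonal n)) (≡⇒≋ (a⊗aWord n)))

powAX-elsewhere : ∀ n i j → i ≢ n ⊎ j ≢ 0 → powAX n i j ≋ 𝟘
powAX-elsewhere zero zero zero (inj₁ ne) = ⊥-elim (ne refl)
powAX-elsewhere zero zero zero (inj₂ ne) = ⊥-elim (ne refl)
powAX-elsewhere zero zero (suc j) _ = ≋-refl
powAX-elsewhere zero (suc i) j _ = ≋-refl
powAX-elsewhere (suc n) zero j _ = powAX-suc n zero j
powAX-elsewhere (suc n) (suc i) j off =
  ≋-trans (powAX-suc n (suc i) j)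
    (≋-trans (⊗-congʳ letter-a (powAX-elsewhere n i j (Sum.map₁ (λ ne e → ne (cong suc e)) off)))
             (≡⇒≋ (⊗-zeroʳ letter-a)))

powAY-elsewhere : ∀ n i j → i ≢ 0 ⊎ j ≢ n → powAY n i j ≋ 𝟘
powAY-elsewhere zero zero zero (inj₁ ne) = ⊥-elim (ne refl)
powAY-elsewhere zero zero zero (inj₂ ne) = ⊥-elim (ne refl)
powAY-elsewhere zero zero (suc j) _ = ≋-refl
powAY-elsewhere zero (suc i) j _ = ≋-refl
powAY-elsewhere (suc n) i zero _ = powAY-suc n i zero
powAY-elsewhere (suc n) i (suc j) off =
  ≋-trans (powAY-suc n i (suc j))
    (≋-trans (⊗-congʳ letter-a (powAY-elsewhere n i j (Sum.map₂ (λ ne e → ne (cong suc e)) off)))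
             (≡⇒≋ (⊗-zeroʳ letter-a)))

geom-aX : geom (cst letter-a *S Xs) ≋S alongX (λ i → word (aWord i))
geom-aX i zero =
  ≋-trans (≡⇒≋ (cong (λ m → sum𝔥 (suc m) (λ n → powAX n i 0)) (ℕₚ.+-identityʳ i)))
    (≋-trans (sum𝔥-only-last i (λ n → powAX n i 0)
                (λ n n<i → powAX-elsewhere n i 0 (inj₁ (λ i≡n → ℕₚ.<-irrefl (sym i≡n) n<i))))
             (powAX-diagonal i))
geom-aX i (suc j) = sum𝔥-zero (suc (i + suc j)) (λ n _ → powAX-elsewhere n i (suc j) (inj₂ (λ ())))

geom-aY : geom (cst letter-a *S Ys) ≋S alongY (λ j → word (aWord j))
geom-aY zero j =
  ≋-trans (sum𝔥-only-last j (λ n → powAY n 0 j)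
             (λ n n<j → powAY-elsewhere n 0 j (inj₂ (λ j≡n → ℕₚ.<-irrefl (sym j≡n) n<j))))
          (powAY-diagonal j)
geom-aY (suc i) j = sum𝔥-zero (suc (suc i + j)) (λ n _ → powAY-elsewhere n (suc i) j (inj₁ (λ ())))

cst-*S-geom-aX : ∀ c → cst c *S geom (cst letter-a *S Xs) ≋S alongX (λ i → c ◂* aWord i)
cst-*S-geom-aX c i j = ≋-trans (Conv⊗.conv-cstˡ c (geom (cst letter-a *S Xs)) i j) (≋-trans (⊗-congʳ c (geom-aX i j)) (alongX-word i j))
  where
  alongX-word : ∀ i j → c ⊗ alongX (λ i → word (aWord i)) i j ≋ alongX (λ i → c ◂* aWord i) i j
  alongX-word i zero = ≡⇒≋ (⊗-word c (aWord i))
  alongX-word i (suc j) = ≡⇒≋ (⊗-zeroʳ c)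

cst-*S-geom-aY : ∀ c → cst c *S geom (cst letter-a *S Ys) ≋S alongY (λ j → c ◂* aWord j)
cst-*S-geom-aY c i j = ≋-trans (Conv⊗.conv-cstˡ c (geom (cst letter-a *S Ys)) i j) (≋-trans (⊗-congʳ c (geom-aY i j)) (alongY-word i j))
  where
  alongY-word : ∀ i j → c ⊗ alongY (λ j → word (aWord j)) i j ≋ alongY (λ j → c ◂* aWord j) i j
  alongY-word zero j = ≡⇒≋ (⊗-word c (aWord j))
  alongY-word (suc i) j = ≡⇒≋ (⊗-zeroʳ c)

-- The geometric series G in a(X + Y + ħXY)

-- stepXY H is the coefficient array of (X + Y + ħXY)·H.
stepXY : Ser → Ser
stepXY H i j = timesX H i j ⊕ timesY H i j ⊕ ħ· (timesX (timesY H) i j)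

stepXY-cong : ∀ {F G} → F ≋S G → stepXY F ≋S stepXY G
stepXY-cong e i j =
  ⊕-cong (⊕-cong (timesX-cong e i j) (timesY-cong e i j)) (ħ·-cong (timesX-cong (timesY-cong e) i j))

⊗-stepXY : ∀ c H i j → c ⊗ stepXY H i j ≋ stepXY (λ a b → c ⊗ H a b) i j
⊗-stepXY c H i j =
  ≋-trans (⊗-distribˡ c (timesX H i j ⊕ timesY H i j) (ħ· (timesX (timesY H) i j)))
    (⊕-cong (≋-trans (⊗-distribˡ c (timesX H i j) (timesY H i j)) (⊕-cong (⊗-timesX c H i j) (⊗-timesY c H i j)))
            (≋-trans (≡⇒≋ (⊗-ħ·ʳ c (timesX (timesY H) i j)))
                     (ħ·-cong (≋-trans (⊗-timesX c (timesY H) i j) (timesX-cong (⊗-timesY c H) i j)))))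

*S-stepXY : ∀ F H → F *S stepXY H ≋S stepXY (F *S H)
*S-stepXY F H i j =
  ≋-trans (Conv⊗.conv-distribˡ F (λ a b → timesX H a b ⊕ timesY H a b) (λ a b → ħ· (timesX (timesY H) a b)) i j)
    (⊕-cong (≋-trans (Conv⊗.conv-distribˡ F (timesX H) (timesY H) i j)
                     (⊕-cong (Conv⊗.conv-timesXʳ F H i j) (Conv⊗.conv-timesYʳ F H i j)))
            (≋-trans (*S-ħ·ʳ F (timesX (timesY H)) i j)
                     (ħ·-cong (≋-trans (Conv⊗.conv-timesXʳ F (timesY H) i j) (timesX-cong (Conv⊗.conv-timesYʳ F H) i j)))))

ħa : 𝔥
ħa = ħ· letter-a

XYSeries : Ser
XYSeries = Xs +S Ys +S cst ħ *S Xs *S Ys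

cst-a-*S-XYSeries : cst letter-a *S XYSeries ≋S
  λ i j → timesX (cst letter-a) i j ⊕ timesY (cst letter-a) i j ⊕ timesX (timesY (cst ħa)) i j
cst-a-*S-XYSeries i j =
  ≋-trans (Conv⊗.conv-cstˡ letter-a XYSeries i j)
  (≋-trans (⊗-distribˡ letter-a (Xs i j ⊕ Ys i j) ((cst ħ *S Xs *S Ys) i j))
  (⊕-cong (≋-trans (⊗-distribˡ letter-a (Xs i j) (Ys i j))
                   (⊕-cong (⊗-Xs letter-a i j) (⊗-Ys letter-a i j)))
          (≋-trans (⊗-congʳ letter-a (ħXY i j)) (a⊗timesXY i j))))
  where
  ħXY : cst ħ *S Xs *S Ys ≋S timesX (timesY (cst ħ))
  ħXY i j = ≋-trans (Conv⊗.conv-congˡ Ys (cst-*S-Xs ħ) i j)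
    (≋-trans (Conv⊗.conv-timesXˡ (cst ħ) Ys i j) (timesX-cong (cst-*S-Ys ħ) i j))
  a⊗timesXY : ∀ i j → letter-a ⊗ timesX (timesY (cst ħ)) i j ≋ timesX (timesY (cst ħa)) i j
  a⊗timesXY zero j = ≡⇒≋ (⊗-zeroʳ letter-a)
  a⊗timesXY (suc i) zero = ≡⇒≋ (⊗-zeroʳ letter-a)
  a⊗timesXY (suc zero) (suc zero) = ≋-refl
  a⊗timesXY (suc zero) (suc (suc j)) = ≡⇒≋ (⊗-zeroʳ letter-a)
  a⊗timesXY (suc (suc i)) (suc j) = ≡⇒≋ (⊗-zeroʳ letter-a)

powAXY : ℕ → Ser
powAXY = powS (cst letter-a *S XYSeries)

left-a left-ħa : Ser → Ser
left-a H i j = letter-a ⊗ H i j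
left-ħa H i j = ħa ⊗ H i j

powAXY-suc : ∀ n i j → powAXY (suc n) i j ≋
  timesX (left-a (powAXY n)) i j ⊕ timesY (left-a (powAXY n)) i j ⊕ timesX (timesY (left-ħa (powAXY n))) i j
powAXY-suc n i j =
  ≋-trans (Conv⊗.conv-congˡ (powAXY n) cst-a-*S-XYSeries i j)
  (≋-trans (Conv⊗.conv-distribʳ (λ a b → timesX (cst letter-a) a b ⊕ timesY (cst letter-a) a b)
                                (timesX (timesY (cst ħa))) (powAXY n) i j)
  (⊕-cong (≋-trans (Conv⊗.conv-distribʳ (timesX (cst letter-a)) (timesY (cst letter-a)) (powAXY n) i j)
             (⊕-cong (≋-trans (Conv⊗.conv-timesXˡ (cst letter-a) (powAXY n) i j)
                              (timesX-cong (Conv⊗.conv-cstˡ letter-a (powAXY n)) i j))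
                     (≋-trans (Conv⊗.conv-timesYˡ (cst letter-a) (powAXY n) i j)
                              (timesY-cong (Conv⊗.conv-cstˡ letter-a (powAXY n)) i j))))
          (≋-trans (Conv⊗.conv-timesXˡ (timesY (cst ħa)) (powAXY n) i j)
             (timesX-cong (λ a b → ≋-trans (Conv⊗.conv-timesYˡ (cst ħa) (powAXY n) a b)
                                           (timesY-cong (Conv⊗.conv-cstˡ ħa (powAXY n)) a b)) i j))))

powAXY-vanishes : ∀ n i j → i + j < n → powAXY n i j ≋ 𝟘
powAXY-vanishes (suc n) i j lt = ≋-trans (powAXY-suc n i j) (⊕-cong (⊕-cong (inX i j lt) (inY i j lt)) (inXY i j lt))
  where
  below : ∀ c i j → i + j < n → c ⊗ powAXY n i j ≋ 𝟘
  below c i j lt = ≋-trans (⊗-congʳ c (powAXY-vanishes n i j lt)) (≡⇒≋ (⊗-zeroʳ c))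
  inX : ∀ i j → i + j < suc n → timesX (left-a (powAXY n)) i j ≋ 𝟘
  inX zero j lt = ≋-refl
  inX (suc i) j lt = below letter-a i j (ℕₚ.≤-pred lt)
  inY : ∀ i j → i + j < suc n → timesY (left-a (powAXY n)) i j ≋ 𝟘
  inY i zero lt = ≋-refl
  inY i (suc j) lt = below letter-a i j (ℕₚ.≤-pred (subst (_< suc n) (ℕₚ.+-suc i j) lt))
  inXY : ∀ i j → i + j < suc n → timesX (timesY (left-ħa (powAXY n))) i j ≋ 𝟘
  inXY zero j lt = ≋-refl
  inXY (suc i) zero lt = ≋-refl
  inXY (suc i) (suc j) lt = below ħa i j (ℕₚ.≤-trans (s≤s (ℕₚ.+-monoʳ-≤ i (ℕₚ.n≤1+n j))) (ℕₚ.≤-pred lt))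

G : Ser
G = geom (cst letter-a *S XYSeries)

G-recursionˡ : ∀ i j → G i j ≋
  cst 𝟙 i j ⊕ (timesX (left-a G) i j ⊕ timesY (left-a G) i j ⊕ timesX (timesY (left-ħa G)) i j)
G-recursionˡ i j =
  ≋-trans (sum𝔥-first (i + j) (λ n → powAXY n i j))
  (⊕-cong ≋-refl
  (≋-trans (sum𝔥-cong (i + j) (λ n _ → powAXY-suc n i j))
  (≋-trans (sum𝔥-⊕ (i + j) (λ n → timesX (left-a (powAXY n)) i j ⊕ timesY (left-a (powAXY n)) i j)
                           (λ n → timesX (timesY (left-ħa (powAXY n))) i j))
  (⊕-cong (≋-trans (sum𝔥-⊕ (i + j) (λ n → timesX (left-a (powAXY n)) i j) (λ n → timesY (left-a (powAXY n)) i j))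
                   (⊕-cong (sumX i j) (sumY i j)))
          (sumXY i j)))))
  where
  sumX : ∀ i j → sum𝔥 (i + j) (λ n → timesX (left-a (powAXY n)) i j) ≋ timesX (left-a G) i j
  sumX zero j = sum𝔥-zero j (λ _ _ → ≋-refl)
  sumX (suc i) j = ≋-sym (⊗-sum𝔥 letter-a (suc (i + j)) (λ n → powAXY n i j))
  sumY : ∀ i j → sum𝔥 (i + j) (λ n → timesY (left-a (powAXY n)) i j) ≋ timesY (left-a G) i j
  sumY i zero = sum𝔥-zero (i + 0) (λ _ _ → ≋-refl)
  sumY i (suc j) = ≋-trans (≡⇒≋ (cong (λ m → sum𝔥 m (λ n → letter-a ⊗ powAXY n i j)) (ℕₚ.+-suc i j)))
    (≋-sym (⊗-sum𝔥 letter-a (suc (i + j)) (λ n → powAXY n i j)))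
  -- The sum defining G i j stops one term earlier than the one here; that term vanishes.
  sumXY : ∀ i j → sum𝔥 (i + j) (λ n → timesX (timesY (left-ħa (powAXY n))) i j) ≋ timesX (timesY (left-ħa G)) i j
  sumXY zero j = sum𝔥-zero j (λ _ _ → ≋-refl)
  sumXY (suc i) zero = sum𝔥-zero (suc (i + 0)) (λ _ _ → ≋-refl)
  sumXY (suc i) (suc j) = ≋-trans (≡⇒≋ (cong (λ m → sum𝔥 (suc m) (λ n → ħa ⊗ powAXY n i j)) (ℕₚ.+-suc i j)))
    (≋-trans (⊕-cong ≋-refl (≋-trans (⊗-congʳ ħa (powAXY-vanishes (suc (i + j)) i j ℕₚ.≤-refl)) (≡⇒≋ (⊗-zeroʳ ħa))))
    (≋-trans (⊕-identityʳ _) (≋-sym (⊗-sum𝔥 ħa (suc (i + j)) (λ n → powAXY n i j)))))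

CommutesWithA : 𝔥 → Set
CommutesWithA x = letter-a ⊗ x ≋ x ◂ 𝕒

commutesWithA-𝟘 : CommutesWithA 𝟘
commutesWithA-𝟘 = ≡⇒≋ (⊗-zeroʳ letter-a)

commutesWithA-cst𝟙 : ∀ i j → CommutesWithA (cst 𝟙 i j)
commutesWithA-cst𝟙 zero zero = ≋-refl
commutesWithA-cst𝟙 zero (suc j) = commutesWithA-𝟘
commutesWithA-cst𝟙 (suc i) j = commutesWithA-𝟘

commutesWithA-⊕ : ∀ {x y} → CommutesWithA x → CommutesWithA y → CommutesWithA (x ⊕ y)
commutesWithA-⊕ {x} {y} cx cy =
  ≋-trans (⊗-distribˡ letter-a x y) (≋-trans (⊕-cong cx cy) (≡⇒≋ (sym (◂-distrib-⊕ x y 𝕒))))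

commutesWithA-resp-≋ : ∀ {x y} → x ≋ y → CommutesWithA x → CommutesWithA y
commutesWithA-resp-≋ e cx = ≋-trans (⊗-congʳ letter-a (≋-sym e)) (≋-trans cx (◂-cong 𝕒 e))

commutesWithA-a⊗ : ∀ {x} → CommutesWithA x → CommutesWithA (letter-a ⊗ x)
commutesWithA-a⊗ {x} cx = ≋-trans (⊗-congʳ letter-a cx) (≡⇒≋ (⊗-◂ letter-a x 𝕒))

commutesWithA-ħa⊗ : ∀ {x} → CommutesWithA x → CommutesWithA (ħa ⊗ x)
commutesWithA-ħa⊗ {x} cx =
  ≋-trans (≡⇒≋ (trans (cong (letter-a ⊗_) (ħ·-⊗ˡ letter-a x)) (⊗-ħ·ʳ letter-a (letter-a ⊗ x))))
  (≋-trans (ħ·-cong (commutesWithA-a⊗ cx))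
           (≡⇒≋ (trans (ħ·-◂ (letter-a ⊗ x) 𝕒) (cong (_◂ 𝕒) (sym (ħ·-⊗ˡ letter-a x))))))

-- The coefficients of G are polynomials in a and ħ.
commutesWithA-G : ∀ i j → CommutesWithA (G i j)
commutesWithA-G i j = commutesWithA-resp-≋ (≋-sym (G-recursionˡ i j))
  (commutesWithA-⊕ (commutesWithA-cst𝟙 i j)
    (commutesWithA-⊕ (commutesWithA-⊕ (inX i j) (inY i j)) (inXY i j)))
  where
  inX : ∀ i j → CommutesWithA (timesX (left-a G) i j)
  inX zero j = commutesWithA-𝟘
  inX (suc i) j = commutesWithA-a⊗ (commutesWithA-G i j)
  inY : ∀ i j → CommutesWithA (timesY (left-a G) i j)
  inY i zero = commutesWithA-𝟘
  inY i (suc j) = commutesWithA-a⊗ (commutesWithA-G i j)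
  inXY : ∀ i j → CommutesWithA (timesX (timesY (left-ħa G)) i j)
  inXY zero j = commutesWithA-𝟘
  inXY (suc i) zero = commutesWithA-𝟘
  inXY (suc i) (suc j) = commutesWithA-ħa⊗ (commutesWithA-G i j)

G-recursionʳ : ∀ i j → G i j ≋ cst 𝟙 i j ⊕ stepXY G i j ◂ 𝕒
G-recursionʳ i j = ≋-trans (G-recursionˡ i j) (⊕-cong ≋-refl
  (≋-trans (⊕-cong (⊕-cong (inX i j) (inY i j)) (inXY i j))
           (≡⇒≋ (sym (◂-distrib-⊕₃ (timesX G i j) (timesY G i j) (ħ· (timesX (timesY G) i j)) 𝕒)))))
  where
  inX : ∀ i j → timesX (left-a G) i j ≋ timesX G i j ◂ 𝕒
  inX zero j = ≋-refl
  inX (suc i) j = commutesWithA-G i j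
  inY : ∀ i j → timesY (left-a G) i j ≋ timesY G i j ◂ 𝕒
  inY i zero = ≋-refl
  inY i (suc j) = commutesWithA-G i j
  inXY : ∀ i j → timesX (timesY (left-ħa G)) i j ≋ ħ· (timesX (timesY G) i j) ◂ 𝕒
  inXY zero j = ≋-refl
  inXY (suc i) zero = ≋-refl
  inXY (suc i) (suc j) =
    ≋-trans (≡⇒≋ (ħ·-⊗ˡ letter-a (G i j))) (≋-trans (ħ·-cong (commutesWithA-G i j)) (≡⇒≋ (ħ·-◂ (G i j) 𝕒)))

K : Ser
K = cst g₁ *S G

K≋g₁⊗G : K ≋S λ i j → g₁ ⊗ G i j
K≋g₁⊗G = Conv⊗.conv-cstˡ g₁ G

K-recursion : ∀ i j → K i j ≋ cst g₁ i j ⊕ stepXY K i j ◂ 𝕒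
K-recursion i j = begin
  K i j                                                 ≈⟨ K≋g₁⊗G i j ⟩
  g₁ ⊗ G i j                                            ≈⟨ ⊗-congʳ g₁ (G-recursionʳ i j) ⟩
  g₁ ⊗ (cst 𝟙 i j ⊕ stepXY G i j ◂ 𝕒)                   ≈⟨ ⊗-distribˡ g₁ (cst 𝟙 i j) (stepXY G i j ◂ 𝕒) ⟩
  g₁ ⊗ cst 𝟙 i j ⊕ g₁ ⊗ (stepXY G i j ◂ 𝕒)              ≈⟨ ⊕-cong (⊗-cst𝟙 g₁ i j) (≡⇒≋ (⊗-◂ g₁ (stepXY G i j) 𝕒)) ⟩
  cst g₁ i j ⊕ (g₁ ⊗ stepXY G i j) ◂ 𝕒                  ≈⟨ ⊕-cong ≋-refl (◂-cong 𝕒 (⊗-stepXY g₁ G i j)) ⟩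
  cst g₁ i j ⊕ stepXY (λ a b → g₁ ⊗ G a b) i j ◂ 𝕒      ≈⟨ ⊕-cong ≋-refl (◂-cong 𝕒 (stepXY-cong (λ a b → ≋-sym (K≋g₁⊗G a b)) i j)) ⟩
  cst g₁ i j ⊕ stepXY K i j ◂ 𝕒                         ∎
  where open ≋-Reasoning

SolvesRec : Ser → Ser → Set
SolvesRec B T = ∀ i j → T i j ≋ (B i j ⊕ stepXY T i j) ◂ 𝕒

SolvesRec-unique : ∀ {B B' T T'} → B ≋S B' → SolvesRec B T → SolvesRec B' T' → T ≋S T'
SolvesRec-unique {B} {B'} {T} {T'} eB s s' = agree
  where
  step : ∀ i j → stepXY T i j ≋ stepXY T' i j → T i j ≋ T' i j
  step i j e = ≋-trans (s i j) (≋-trans (◂-cong 𝕒 (⊕-cong (eB i j) e)) (≋-sym (s' i j)))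
  agree : T ≋S T'
  agree zero zero = step 0 0 ≋-refl
  agree (suc i) zero = step (suc i) 0 (⊕-cong (⊕-cong (agree i 0) ≋-refl) ≋-refl)
  agree zero (suc j) = step 0 (suc j) (⊕-cong {T 0 j} {T' 0 j} {𝟘} {𝟘} (agree 0 j) ≋-refl)
  agree (suc i) (suc j) =
    step (suc i) (suc j) (⊕-cong (⊕-cong (agree i (suc j)) (agree (suc i) j)) (ħ·-cong (agree i j)))

*S-K-SolvesRec : ∀ F → SolvesRec (λ i j → F i j ◂ 𝕓) (F *S K)
*S-K-SolvesRec F i j = begin
  (F *S K) i j                                          ≈⟨ Conv⊗.conv-congʳ F (λ a b → K-recursion a b) i j ⟩
  (F *S (λ a b → cst g₁ a b ⊕ stepXY K a b ◂ 𝕒)) i j    ≈⟨ Conv⊗.conv-distribˡ F (cst g₁) (λ a b → stepXY K a b ◂ 𝕒) i j ⟩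
  (F *S cst g₁) i j ⊕ (F *S (λ a b → stepXY K a b ◂ 𝕒)) i j
    ≈⟨ ⊕-cong (≋-trans (Conv⊗.conv-cstʳ F g₁ i j) (≡⇒≋ (⊗-g₁ (F i j)))) (*S-◂ʳ F (stepXY K) 𝕒 i j) ⟩
  (F i j ◂ 𝕓) ◂ 𝕒 ⊕ (F *S stepXY K) i j ◂ 𝕒            ≈⟨ ⊕-cong ≋-refl (◂-cong 𝕒 (*S-stepXY F K i j)) ⟩
  (F i j ◂ 𝕓) ◂ 𝕒 ⊕ stepXY (F *S K) i j ◂ 𝕒            ≡⟨ sym (◂-distrib-⊕ (F i j ◂ 𝕓) (stepXY (F *S K) i j) 𝕒) ⟩
  (F i j ◂ 𝕓 ⊕ stepXY (F *S K) i j) ◂ 𝕒                ∎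
  where open ≋-Reasoning

one+ħX-*S : ∀ H → (cst 𝟙 +S cst ħ *S Xs) *S H ≋S λ i j → H i j ⊕ timesX (λ a b → ħ· (H a b)) i j
one+ħX-*S H i j =
  ≋-trans (Conv⊗.conv-congˡ H (λ a b → ⊕-cong (≋-refl {cst 𝟙 a b}) (cst-*S-Xs ħ a b)) i j)
  (≋-trans (Conv⊗.conv-distribʳ (cst 𝟙) (timesX (cst ħ)) H i j)
  (⊕-cong (≋-trans (Conv⊗.conv-cstˡ 𝟙 H i j) (≡⇒≋ (⊗-identityˡ (H i j))))
          (≋-trans (Conv⊗.conv-timesXˡ (cst ħ) H i j)
                   (timesX-cong (λ a b → ≋-trans (Conv⊗.conv-cstˡ ħ H a b) (≡⇒≋ (ħ-⊗ (H a b)))) i j))))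

one+ħY-*S : ∀ H → (cst 𝟙 +S cst ħ *S Ys) *S H ≋S λ i j → H i j ⊕ timesY (λ a b → ħ· (H a b)) i j
one+ħY-*S H i j =
  ≋-trans (Conv⊗.conv-congˡ H (λ a b → ⊕-cong (≋-refl {cst 𝟙 a b}) (cst-*S-Ys ħ a b)) i j)
  (≋-trans (Conv⊗.conv-distribʳ (cst 𝟙) (timesY (cst ħ)) H i j)
  (⊕-cong (≋-trans (Conv⊗.conv-cstˡ 𝟙 H i j) (≡⇒≋ (⊗-identityˡ (H i j))))
          (≋-trans (Conv⊗.conv-timesYˡ (cst ħ) H i j)
                   (timesY-cong (λ a b → ≋-trans (Conv⊗.conv-cstˡ ħ H a b) (≡⇒≋ (ħ-⊗ (H a b)))) i j))))

alongX-ш : ∀ f y i j → alongX f i j ш y ≡ alongX (λ i → f i ш y) i j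
alongX-ш f y i zero = refl
alongX-ш f y i (suc j) = refl

ш-alongY : ∀ x g i j → x ш alongY g i j ≡ alongY (λ j → x ш g j) i j
ш-alongY x g zero j = refl
ш-alongY x g (suc i) j = ш-zeroʳ x

e₁⊖g₁≋ħb : e₁ ⊖ g₁ ≋ ħ· letter-b
e₁⊖g₁≋ħb = ≈⇒≋ λ k w → cancel (sameKey k w 0 (ε ▸ 𝕓 ▸ 𝕒)) (if sameKey k w 1 (ε ▸ 𝕓) then 1ℚ else 0ℚ)
  where
  cancel : ∀ b t → (if b then 1ℚ else 0ℚ) +ℚ (t +ℚ ((if b then - 1ℚ else 0ℚ) +ℚ 0ℚ)) ≡ t +ℚ 0ℚ
  cancel true t = solve 1 (λ t → con 1ℚ :+ (t :+ (con (- 1ℚ) :+ con 0ℚ)) := t :+ con 0ℚ) refl t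
  cancel false t = solve 1 (λ t → con 0ℚ :+ (t :+ (con 0ℚ :+ con 0ℚ)) := t :+ con 0ℚ) refl t

⊗-e₁⊖g₁ : ∀ x → x ⊗ (e₁ ⊖ g₁) ≋ ħ· (x ◂ 𝕓)
⊗-e₁⊖g₁ x = ≋-trans (⊗-congʳ x e₁⊖g₁≋ħb) (≡⇒≋ (begin
  x ⊗ ħ· letter-b      ≡⟨ ⊗-ħ·ʳ x letter-b ⟩
  ħ· (x ⊗ letter-b)    ≡⟨ cong ħ· (⊗-word x (ε ▸ 𝕓)) ⟩
  ħ· (x ◂* (ε ▸ 𝕓))    ≡⟨ cong ħ· (trans (◂*-▸ x ε 𝕓) (cong (_◂ 𝕓) (◂*-ε x))) ⟩
  ħ· (x ◂ 𝕓)           ∎))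
  where open ≡-Reasoning

module ShuffleOfGeometricSeries (u v : 𝔥) where

  U V : ℕ → 𝔥
  U i = (u ⊗ g₁) ◂* aWord i
  V j = (v ⊗ g₁) ◂* aWord j

  U-zero : U 0 ≡ (u ◂ 𝕓) ◂ 𝕒
  U-zero = trans (◂*-ε (u ⊗ g₁)) (⊗-g₁ u)

  V-zero : V 0 ≡ (v ◂ 𝕓) ◂ 𝕒
  V-zero = trans (◂*-ε (v ⊗ g₁)) (⊗-g₁ v)

  U-suc : ∀ i → U (suc i) ≡ U i ◂ 𝕒
  U-suc i = ◂*-▸ (u ⊗ g₁) (aWord i) 𝕒

  V-suc : ∀ j → V (suc j) ≡ V j ◂ 𝕒
  V-suc j = ◂*-▸ (v ⊗ g₁) (aWord j) 𝕒

  A B : Ser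
  A = cst (u ⊗ g₁) *S geom (cst letter-a *S Xs)
  B = cst (v ⊗ g₁) *S geom (cst letter-a *S Ys)

  W : Ser
  W i j = U i ш V j

  A-шS-B : A шS B ≋S W
  A-шS-B i j = ≋-trans (Convш.conv-congˡ B (cst-*S-geom-aX (u ⊗ g₁)) i j)
    (≋-trans (Convш.conv-congʳ (alongX U) (cst-*S-geom-aY (v ⊗ g₁)) i j) (Convш.conv-alongX-alongY U V i j))

  boundary : Ser
  boundary zero zero = U 0 ш v ⊕ u ш V 0 ⊕ ħ· ((u ш v) ◂ 𝕓)
  boundary (suc i) zero = U (suc i) ш v ⊕ ħ· (U i ш v)
  boundary zero (suc j) = u ш V (suc j) ⊕ ħ· (u ш V j)
  boundary (suc i) (suc j) = 𝟘

  W-SolvesRec : SolvesRec (λ i j → boundary i j ◂ 𝕓) W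
  W-SolvesRec zero zero = begin
    W 0 0                                          ≡⟨ cong₂ _ш_ U-zero V-zero ⟩
    ((u ◂ 𝕓) ◂ 𝕒) ш ((v ◂ 𝕓) ◂ 𝕒)                  ≈⟨ ш-◂𝕒 (u ◂ 𝕓) (v ◂ 𝕓) ⟩
    (((u ◂ 𝕓) ◂ 𝕒) ш (v ◂ 𝕓) ⊕ (u ◂ 𝕓) ш ((v ◂ 𝕓) ◂ 𝕒) ⊕ ħ· ((u ◂ 𝕓) ш (v ◂ 𝕓))) ◂ 𝕒
      ≡⟨ cong (_◂ 𝕒) (cong₂ _⊕_ (cong₂ _⊕_ left right) (trans (cong ħ· both) (ħ·-◂ ((u ш v) ◂ 𝕓) 𝕓))) ⟩
    ((U 0 ш v) ◂ 𝕓 ⊕ (u ш V 0) ◂ 𝕓 ⊕ ħ· ((u ш v) ◂ 𝕓) ◂ 𝕓) ◂ 𝕒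
      ≡⟨ cong (_◂ 𝕒) (sym (◂-distrib-⊕₃ (U 0 ш v) (u ш V 0) (ħ· ((u ш v) ◂ 𝕓)) 𝕓)) ⟩
    (boundary 0 0 ◂ 𝕓) ◂ 𝕒                         ≈⟨ ◂-cong 𝕒 (≋-sym (⊕-identityʳ (boundary 0 0 ◂ 𝕓))) ⟩
    (boundary 0 0 ◂ 𝕓 ⊕ stepXY W 0 0) ◂ 𝕒          ∎
    where
    open ≋-Reasoning
    left : ((u ◂ 𝕓) ◂ 𝕒) ш (v ◂ 𝕓) ≡ (U 0 ш v) ◂ 𝕓
    left = trans (ш-◂𝕓ʳ ((u ◂ 𝕓) ◂ 𝕒) v) (cong (λ z → (z ш v) ◂ 𝕓) (sym U-zero))
    right : (u ◂ 𝕓) ш ((v ◂ 𝕓) ◂ 𝕒) ≡ (u ш V 0) ◂ 𝕓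
    right = trans (ш-◂𝕓ˡ u ((v ◂ 𝕓) ◂ 𝕒)) (cong (λ z → (u ш z) ◂ 𝕓) (sym V-zero))
    both : (u ◂ 𝕓) ш (v ◂ 𝕓) ≡ ((u ш v) ◂ 𝕓) ◂ 𝕓
    both = trans (ш-◂𝕓ˡ u (v ◂ 𝕓)) (cong (_◂ 𝕓) (ш-◂𝕓ʳ u v))
  W-SolvesRec (suc i) zero = begin
    W (suc i) 0                                    ≡⟨ cong₂ _ш_ (U-suc i) V-zero ⟩
    (U i ◂ 𝕒) ш ((v ◂ 𝕓) ◂ 𝕒)                      ≈⟨ ш-◂𝕒 (U i) (v ◂ 𝕓) ⟩
    ((U i ◂ 𝕒) ш (v ◂ 𝕓) ⊕ U i ш ((v ◂ 𝕓) ◂ 𝕒) ⊕ ħ· (U i ш (v ◂ 𝕓))) ◂ 𝕒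
      ≡⟨ cong (_◂ 𝕒) (cong₂ _⊕_ (cong₂ _⊕_ left (cong (U i ш_) (sym V-zero)))
                                (trans (cong ħ· (ш-◂𝕓ʳ (U i) v)) (ħ·-◂ (U i ш v) 𝕓))) ⟩
    ((U (suc i) ш v) ◂ 𝕓 ⊕ W i 0 ⊕ ħ· (U i ш v) ◂ 𝕓) ◂ 𝕒
      ≈⟨ ◂-cong 𝕒 (xy∙z≈xz∙y ((U (suc i) ш v) ◂ 𝕓) (W i 0) (ħ· (U i ш v) ◂ 𝕓)) ⟩
    ((U (suc i) ш v) ◂ 𝕓 ⊕ ħ· (U i ш v) ◂ 𝕓 ⊕ W i 0) ◂ 𝕒
      ≡⟨ cong (λ z → (z ⊕ W i 0) ◂ 𝕒) (sym (◂-distrib-⊕ (U (suc i) ш v) (ħ· (U i ш v)) 𝕓)) ⟩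
    (boundary (suc i) 0 ◂ 𝕓 ⊕ W i 0) ◂ 𝕒
      ≈⟨ ◂-cong 𝕒 (⊕-cong ≋-refl (≋-sym (≋-trans (⊕-identityʳ (W i 0 ⊕ 𝟘)) (⊕-identityʳ (W i 0))))) ⟩
    (boundary (suc i) 0 ◂ 𝕓 ⊕ stepXY W (suc i) 0) ◂ 𝕒 ∎
    where
    open ≋-Reasoning
    left : (U i ◂ 𝕒) ш (v ◂ 𝕓) ≡ (U (suc i) ш v) ◂ 𝕓
    left = trans (ш-◂𝕓ʳ (U i ◂ 𝕒) v) (cong (λ z → (z ш v) ◂ 𝕓) (sym (U-suc i)))
  W-SolvesRec zero (suc j) = begin
    W 0 (suc j)                                    ≡⟨ cong₂ _ш_ U-zero (V-suc j) ⟩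
    ((u ◂ 𝕓) ◂ 𝕒) ш (V j ◂ 𝕒)                      ≈⟨ ш-◂𝕒 (u ◂ 𝕓) (V j) ⟩
    (((u ◂ 𝕓) ◂ 𝕒) ш V j ⊕ (u ◂ 𝕓) ш (V j ◂ 𝕒) ⊕ ħ· ((u ◂ 𝕓) ш V j)) ◂ 𝕒
      ≡⟨ cong (_◂ 𝕒) (cong₂ _⊕_ (cong₂ _⊕_ (cong (_ш V j) (sym U-zero)) right)
                                (trans (cong ħ· (ш-◂𝕓ˡ u (V j))) (ħ·-◂ (u ш V j) 𝕓))) ⟩
    (W 0 j ⊕ (u ш V (suc j)) ◂ 𝕓 ⊕ ħ· (u ш V j) ◂ 𝕓) ◂ 𝕒
      ≈⟨ ◂-cong 𝕒 (xy∙z≈yz∙x (W 0 j) ((u ш V (suc j)) ◂ 𝕓) (ħ· (u ш V j) ◂ 𝕓)) ⟩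
    ((u ш V (suc j)) ◂ 𝕓 ⊕ ħ· (u ш V j) ◂ 𝕓 ⊕ W 0 j) ◂ 𝕒
      ≡⟨ cong (λ z → (z ⊕ W 0 j) ◂ 𝕒) (sym (◂-distrib-⊕ (u ш V (suc j)) (ħ· (u ш V j)) 𝕓)) ⟩
    (boundary 0 (suc j) ◂ 𝕓 ⊕ W 0 j) ◂ 𝕒
      ≈⟨ ◂-cong 𝕒 (⊕-cong ≋-refl (≋-sym (⊕-identityʳ (W 0 j)))) ⟩
    (boundary 0 (suc j) ◂ 𝕓 ⊕ stepXY W 0 (suc j)) ◂ 𝕒 ∎
    where
    open ≋-Reasoning
    right : (u ◂ 𝕓) ш (V j ◂ 𝕒) ≡ (u ш V (suc j)) ◂ 𝕓
    right = trans (ш-◂𝕓ˡ u (V j ◂ 𝕒)) (cong (λ z → (u ш z) ◂ 𝕓) (sym (V-suc j)))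
  W-SolvesRec (suc i) (suc j) = begin
    W (suc i) (suc j)                              ≡⟨ cong₂ _ш_ (U-suc i) (V-suc j) ⟩
    (U i ◂ 𝕒) ш (V j ◂ 𝕒)                          ≈⟨ ш-◂𝕒 (U i) (V j) ⟩
    ((U i ◂ 𝕒) ш V j ⊕ U i ш (V j ◂ 𝕒) ⊕ ħ· (W i j)) ◂ 𝕒
      ≡⟨ cong₂ (λ x y → (x ⊕ y ⊕ ħ· (W i j)) ◂ 𝕒) (cong (_ш V j) (sym (U-suc i))) (cong (U i ш_) (sym (V-suc j))) ⟩
    (W (suc i) j ⊕ W i (suc j) ⊕ ħ· (W i j)) ◂ 𝕒   ≈⟨ ◂-cong 𝕒 (xy∙z≈yx∙z (W (suc i) j) (W i (suc j)) (ħ· (W i j))) ⟩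
    (W i (suc j) ⊕ W (suc i) j ⊕ ħ· (W i j)) ◂ 𝕒   ∎
    where open ≋-Reasoning

  F : Ser
  F = ((cst 𝟙 +S cst ħ *S Xs) *S (A шS cst v))
      +S ((cst 𝟙 +S cst ħ *S Ys) *S (cst u шS B))
      +S cst ((u ш v) ⊗ (e₁ ⊖ g₁))

  R C : Ser
  R = alongX (λ i → U i ш v)
  C = alongY (λ j → u ш V j)

  A-шS-v : A шS cst v ≋S R
  A-шS-v i j = ≋-trans (Convш.conv-cstʳ A v i j)
    (≋-trans (ш-congˡ v (cst-*S-geom-aX (u ⊗ g₁) i j)) (≡⇒≋ (alongX-ш U v i j)))

  u-шS-B : cst u шS B ≋S C
  u-шS-B i j = ≋-trans (Convш.conv-cstˡ u B i j)
    (≋-trans (ш-congʳ u (cst-*S-geom-aY (v ⊗ g₁) i j)) (≡⇒≋ (ш-alongY u V i j)))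

  F≋boundary : F ≋S boundary
  F≋boundary i j = ≋-trans
    (⊕-cong (⊕-cong
      (≋-trans (one+ħX-*S (A шS cst v) i j) (⊕-cong (A-шS-v i j) (timesX-cong (λ a b → ħ·-cong (A-шS-v a b)) i j)))
      (≋-trans (one+ħY-*S (cst u шS B) i j) (⊕-cong (u-шS-B i j) (timesY-cong (λ a b → ħ·-cong (u-шS-B a b)) i j))))
      ≋-refl)
    (explicit i j)
    where
    explicit : ∀ i j →
      (R i j ⊕ timesX (λ a b → ħ· (R a b)) i j) ⊕ (C i j ⊕ timesY (λ a b → ħ· (C a b)) i j)
        ⊕ cst ((u ш v) ⊗ (e₁ ⊖ g₁)) i j ≋ boundary i j
    explicit zero zero = ⊕-cong (⊕-cong (⊕-identityʳ (U 0 ш v)) (⊕-identityʳ (u ш V 0))) (⊗-e₁⊖g₁ (u ш v))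
    explicit (suc i) zero = ≋-trans (⊕-identityʳ (boundary (suc i) 0 ⊕ 𝟘)) (⊕-identityʳ (boundary (suc i) 0))
    explicit zero (suc j) = ⊕-identityʳ (boundary 0 (suc j))
    explicit (suc i) (suc j) = ≋-refl

lemma3p10 : (u v : 𝔥) →
    ((cst (u ⊗ g₁) *S geom (cst letter-a *S Xs))
       шS (cst (v ⊗ g₁) *S geom (cst letter-a *S Ys)))
    ≈S
    (((cst 𝟙 +S cst ħ *S Xs) *S ((cst (u ⊗ g₁) *S geom (cst letter-a *S Xs)) шS cst v))
      +S ((cst 𝟙 +S cst ħ *S Ys) *S (cst u шS (cst (v ⊗ g₁) *S geom (cst letter-a *S Ys))))
      +S cst ((u ш v) ⊗ (e₁ ⊖ g₁)))
    *S (cst g₁ *S geom (cst letter-a *S (Xs +S Ys +S cst ħ *S Xs *S Ys)))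
lemma3p10 u v i j = ≋⇒≈ (begin
  (A шS B) i j  ≈⟨ A-шS-B i j ⟩
  W i j         ≈⟨ SolvesRec-unique (λ a b → ◂-cong 𝕓 (≋-sym (F≋boundary a b))) W-SolvesRec (*S-K-SolvesRec F) i j ⟩
  (F *S K) i j  ∎)
  where
  open ShuffleOfGeometricSeries u v
  open ≋-Reasoning
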